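{- Let $m\ge1$, $R=GR(4^m)$ and $\mathcal T=\{0,1,\xi,\dots,\xi^{2^m-2}\}\subseteq R$. Let $\Omega$ be any system of linear equations over $\mathbb Z_4$ in variables $c_x$, $x\in\mathcal T$, which includes the equations $$\sum_{x\in\mathcal T}c_x=0,\qquad \sum_{x\in\mathcal T}c_x x=0,$$ together with (possibly) some equations of the form $2\sum_{x\in\mathcal T}c_x x^{2^j+1}=0$. Then $\Omega$ is invariant under the doubly transitive group $G$ of `affine' permutations of $\mathcal T$ of the form $x\mapsto(ax+b)^{2^m}$ with $a,b\in\mathcal T$, $a\ne0$; i.e. if $(c_x)_{x\in\mathcal T}$ is a solution of $\Omega$ and $g\in G$, then $(c'_y)$ defined by $c'_{g(x)}=c_x$ is also a solution. The order of $G$ is $2^m(2^m-1)$.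
   Context: Let $h_2(X)\in\mathbb Z_2[X]$ be primitive irreducible of degree $m$ and $h(X)\in\mathbb Z_4[X]$ the unique monic degree-$m$ polynomial with $h\equiv h_2\pmod 2$ and $h\mid X^{2^m-1}-1$ in $\mathbb Z_4[X]$. The Galois ring is $R=\mathbb Z_4[X]/(h(X))$ with $\xi$ the class of $X$; equations with coefficients in $R$ are understood as equations in $R$ (equivalently, systems of equations over $\mathbb Z_4$ via the additive representation $c=\sum_{r=0}^{m-1}b_r\xi^r$, $b_r\in\mathbb Z_4$). For $c\in R$, $c^{2^m}\in\mathcal T$. -}

module Defs where

open import Data.Nat as ℕ using (ℕ; zero; suc; _∸_; _^_)
open import Data.Nat.DivMod using (_mod_)
open import Data.Fin as Fin using (Fin; toℕ)
open import Data.Fin.Properties as FinP using (any?)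
open import Data.Vec as Vec using (Vec; []; _∷_)
open import Data.Vec.Properties using (≡-dec)
open import Data.List as List using (List; []; _∷_; [_]; _++_)
open import Data.Product using (Σ; ∃; _×_; _,_)
open import Data.Sum using (_⊎_)
open import Relation.Nullary using (¬_; Dec)
open import Relation.Nullary.Decidable using (_⊎-dec_)
open import Relation.Binary.PropositionalEquality using (_≡_; _≢_)

Z4 : Set
Z4 = Fin 4

Z2 : Set
Z2 = Fin 2

_+₄_ : Z4 → Z4 → Z4
a +₄ b = (toℕ a ℕ.+ toℕ b) mod 4

_*₄_ : Z4 → Z4 → Z4
a *₄ b = (toℕ a ℕ.* toℕ b) mod 4

-₄_ : Z4 → Z4
-₄ a = (4 ∸ toℕ a) mod 4

0₄ 1₄ 2₄ : Z4
0₄ = Fin.zero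
1₄ = Fin.suc Fin.zero
2₄ = Fin.suc (Fin.suc Fin.zero)

_+₂_ : Z2 → Z2 → Z2
a +₂ b = (toℕ a ℕ.+ toℕ b) mod 2

_*₂_ : Z2 → Z2 → Z2
a *₂ b = (toℕ a ℕ.* toℕ b) mod 2

-₂_ : Z2 → Z2
-₂ a = (2 ∸ toℕ a) mod 2

0₂ 1₂ : Z2
0₂ = Fin.zero
1₂ = Fin.suc Fin.zero

red : Z4 → Z2
red a = toℕ a mod 2

-- Univariate polynomials over a commutative ring A, as coefficient lists
-- (lowest degree first); equality of polynomials is equality of all
-- coefficients (so trailing zeros are irrelevant).

module Poly {A : Set} (0# 1# : A) (_+_ _*_ : A → A → A) (-_ : A → A) where

  Pol : Set
  Pol = List A

  _⊕_ : Pol → Pol → Pol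
  [] ⊕ q = q
  (a ∷ p) ⊕ [] = a ∷ p
  (a ∷ p) ⊕ (b ∷ q) = (a + b) ∷ (p ⊕ q)

  scale : A → Pol → Pol
  scale a = List.map (a *_)

  _⊗_ : Pol → Pol → Pol
  [] ⊗ q = []
  (a ∷ p) ⊗ q = scale a q ⊕ (0# ∷ (p ⊗ q))

  coeff : Pol → ℕ → A
  coeff [] n = 0#
  coeff (a ∷ p) zero = a
  coeff (a ∷ p) (suc n) = coeff p n

  _≈_ : Pol → Pol → Set
  p ≈ q = ∀ n → coeff p n ≡ coeff q n

  Xpow : ℕ → Pol
  Xpow k = List.replicate k 0# ++ [ 1# ]

  Xpow-1 : ℕ → Pol
  Xpow-1 k = Xpow k ⊕ [ - 1# ]

  _∣_ : Pol → Pol → Set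
  d ∣ p = ∃ λ q → (q ⊗ d) ≈ p

  IsUnit : Pol → Set
  IsUnit p = ∃ λ q → (p ⊗ q) ≈ [ 1# ]

  Irreducible : Pol → Set
  Irreducible p = ¬ (p ≈ []) × ¬ IsUnit p
                × (∀ f g → (f ⊗ g) ≈ p → IsUnit f ⊎ IsUnit g)

module P4 = Poly 0₄ 1₄ _+₄_ _*₄_ -₄_
module P2 = Poly 0₂ 1₂ _+₂_ _*₂_ -₂_

-- A primitive polynomial of degree m over Z₂: monic of degree m,
-- irreducible, and X has multiplicative order exactly 2^m - 1 modulo it.
PrimitiveZ2 : ℕ → P2.Pol → Set
PrimitiveZ2 m p =
    P2.coeff p m ≡ 1₂
  × (∀ k → m ℕ.< k → P2.coeff p k ≡ 0₂)
  × P2.Irreducible p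
  × (p P2.∣ P2.Xpow-1 (2 ^ m ∸ 1))
  × (∀ k → 0 ℕ.< k → k ℕ.< 2 ^ m ∸ 1 → ¬ (p P2.∣ P2.Xpow-1 k))

-- The monic polynomial h = X^m + Σ_{i<m} hc_i X^i over Z₄, its reduction
-- modulo 2, and the Galois ring R = Z₄[X]/(h) whose elements are
-- represented by their coordinate vectors (b_0,…,b_{m-1}) w.r.t. 1,ξ,…,ξ^{m-1}.

hPoly : ∀ {m} → Vec Z4 m → P4.Pol
hPoly hc = Vec.toList hc ++ [ 1₄ ]

h2Poly : ∀ {m} → Vec Z4 m → P2.Pol
h2Poly hc = List.map red (hPoly hc)

shiftIn : ∀ {n} → Vec Z4 n → Z4 → Vec Z4 n × Z4
shiftIn [] a = [] , a
shiftIn (x ∷ xs) a with shiftIn xs x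
... | ys , l = (a ∷ ys) , l

one : (n : ℕ) → Vec Z4 n
one zero = []
one (suc n) = 1₄ ∷ Vec.replicate n 0₄

module GR (m : ℕ) (hc : Vec Z4 m) where

  R : Set
  R = Vec Z4 m

  0R : R
  0R = Vec.replicate m 0₄

  1R : R
  1R = one m

  _+R_ : R → R → R
  _+R_ = Vec.zipWith _+₄_

  _·_ : Z4 → R → R
  a · v = Vec.map (a *₄_) v

  -- multiplication by ξ, using ξ^m = - Σ hc_i ξ^i
  ξ* : R → R
  ξ* v with shiftIn v 0₄
  ... | s , l = s +R ((-₄ l) · hc)

  -- Σ_i u_i ξ^i v
  mulL : List Z4 → R → R
  mulL [] v = 0R
  mulL (a ∷ as) v = (a · v) +R mulL as (ξ* v)

  _*R_ : R → R → R
  u *R v = mulL (Vec.toList u) v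

  _^R_ : R → ℕ → R
  x ^R zero = 1R
  x ^R suc n = x *R (x ^R n)

  ξ : R
  ξ = ξ* 1R

  InT : R → Set
  InT x = (x ≡ 0R) ⊎ (Σ (Fin (2 ^ m ∸ 1)) λ i → x ≡ ξ ^R toℕ i)

  _≟R_ : (x y : R) → Dec (x ≡ y)
  _≟R_ = ≡-dec FinP._≟_

  InT? : (x : R) → Dec (InT x)
  InT? x = (x ≟R 0R) ⊎-dec any? (λ i → x ≟R (ξ ^R toℕ i))

  allVec : (n : ℕ) → List (Vec Z4 n)
  allVec zero = [ [] ]
  allVec (suc n) = List.concatMap (λ a → List.map (a ∷_) (allVec n)) (List.allFin 4)

  sumT₄ : (R → Z4) → Z4
  sumT₄ f = List.foldr (λ x acc → f x +₄ acc) 0₄ (List.filter InT? (allVec m))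

  sumTR : (R → R) → R
  sumTR f = List.foldr (λ x acc → f x +R acc) 0R (List.filter InT? (allVec m))

  Solves : (J : ℕ → Set) → (R → Z4) → Set
  Solves J c =
      sumT₄ c ≡ 0₄
    × sumTR (λ x → c x · x) ≡ 0R
    × (∀ j → J j → 2₄ · sumTR (λ x → c x · (x ^R (2 ^ j ℕ.+ 1))) ≡ 0R)

  aff : R → R → R → R
  aff a b x = ((a *R x) +R b) ^R (2 ^ m)

  Param : R × R → Set
  Param (a , b) = InT a × InT b × a ≢ 0R

  affP : R × R → R → R
  affP (a , b) = aff a b

  SameOnT : (R → R) → (R → R) → Set
  SameOnT f g = ∀ x → InT x → f x ≡ g x

-- The ring R = ℤ₄[X]/(h) is modelled on coordinate vectors, multiplication by ξ being a shift
-- followed by the substitution X^m = -hc; R is commutative because every multiplication is a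
-- polynomial in this one ℤ₄-linear map. Modulo 2 (x ≈₂ y iff 2x = 2y) the powers ξ^i, i < N = 2^m - 1,
-- are distinct and nonzero because h mod 2 is primitive, so together with 0 they exhaust the 2^m
-- residues: R/2R is a field and 𝒯 a set of representatives. The map τ c = c^(2^m) depends only on
-- c mod 2, since (y + 2w)² = y², and fixes 𝒯, since ξ^N = 1; it is the Teichmüller lift. Hence
-- x ↦ τ (a x + b) is the affine map of the field R/2R read on 𝒯, which gives the group statements and
-- |G| = 2^m (2^m - 1). For invariance, on 𝒯 one has τ (a x + b) = a x + b + 2 (a b)^e x^e with
-- e = 2^(m-1), and modulo 2 squaring is additive, so Σ c_x x^(2^k) ≡ (Σ c_x x)^(2^k); re-indexing
-- the sums of Ω along the permutation then expresses each equation for c′ through equations for c.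

module Submission where

open import Defs
open import Level using (0ℓ)
open import Algebra.Bundles using (CommutativeRing)
open import Algebra.Bundles.Raw using (RawRing)
open import Algebra.Solver.Ring.AlmostCommutativeRing
  using (_-Raw-AlmostCommutative⟶_; fromCommutativeRing)
import Algebra.Solver.Ring as RingSolver
open import Data.Nat as ℕ using (ℕ; zero; suc; _<_; _≤_; s≤s; _^_; _∸_)
import Data.Nat.Properties as ℕP
open import Data.Fin as Fin using (Fin; toℕ)
open import Data.Fin.Properties as FinP using (all?; any?; _≟_)
import Data.Maybe as Maybe
open import Data.Vec as Vec using (Vec; []; _∷_)
import Data.Vec.Properties as VecP
open import Data.List as List using (List; []; _∷_; [_]; _++_)
open import Data.Product using (Σ; ∃; ∃₂; _,_; _×_; proj₁; proj₂; uncurry)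
open import Data.Sum using (inj₁; inj₂)
open import Data.Empty using (⊥; ⊥-elim)
open import Relation.Nullary using (Dec; ¬_; yes; no)
open import Relation.Nullary.Decidable using (from-yes; _→-dec_; dec⇒maybe; map′)
open import Relation.Binary using (IsEquivalence; Setoid; tri<; tri≈; tri>)
open import Function using (_∘_; mk⇔)
open import Data.List.Relation.Unary.All as All using ([])
import Data.List.Relation.Unary.All.Properties as All
open import Data.List.Relation.Unary.Any using (here; there)
open import Data.List.Relation.Unary.AllPairs using ([]; _∷_)
open import Data.List.Relation.Unary.Unique.Propositional using (Unique)
open import Data.List.Membership.Propositional using (_∈_)
open import Data.List.Membership.Propositional.Properties
  using (∈-map⁺; ∈-map⁻; ∈-allFin; ∈-cartesianProductWith⁺; ∈-filter⁺; ∈-filter⁻)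
open import Data.List.Relation.Unary.Unique.Propositional.Properties using (allFin⁺; cartesianProductWith⁺; filter⁺)
open import Data.List.Membership.Propositional.Properties.WithK using (unique∧set⇒bag)
open import Data.List.Relation.Binary.BagAndSetEquality using (∼bag⇒↭)
open import Data.List.Relation.Binary.Permutation.Propositional using (_↭_; ↭⇒↭ₛ)
open import Data.List.Relation.Binary.Permutation.Propositional.Properties using () renaming (map⁺ to ↭-map⁺)
import Data.List.Relation.Binary.Permutation.Setoid.Properties as PermutationProperties
open import Data.List.Properties using (foldr-map)
open import Algebra.Structures using (IsCommutativeMonoid)
import Relation.Binary.Reasoning.Setoid as ≈-Reasoning
open import Relation.Binary.PropositionalEquality hiding ([_])
open import Relation.Binary.PropositionalEquality.Properties using (setoid)

private variable n : ℕ

+₄-assoc : ∀ a b c → (a +₄ b) +₄ c ≡ a +₄ (b +₄ c)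
+₄-assoc = from-yes (all? λ a → all? λ b → all? λ c → (a +₄ b) +₄ c ≟ a +₄ (b +₄ c))

+₄-comm : ∀ a b → a +₄ b ≡ b +₄ a
+₄-comm = from-yes (all? λ a → all? λ b → a +₄ b ≟ b +₄ a)

+₄-identityˡ : ∀ a → 0₄ +₄ a ≡ a
+₄-identityˡ = from-yes (all? λ a → 0₄ +₄ a ≟ a)

+₄-identityʳ : ∀ a → a +₄ 0₄ ≡ a
+₄-identityʳ = from-yes (all? λ a → a +₄ 0₄ ≟ a)

*₄-assoc : ∀ a b c → (a *₄ b) *₄ c ≡ a *₄ (b *₄ c)
*₄-assoc = from-yes (all? λ a → all? λ b → all? λ c → (a *₄ b) *₄ c ≟ a *₄ (b *₄ c))

*₄-comm : ∀ a b → a *₄ b ≡ b *₄ a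
*₄-comm = from-yes (all? λ a → all? λ b → a *₄ b ≟ b *₄ a)

*₄-identityˡ : ∀ a → 1₄ *₄ a ≡ a
*₄-identityˡ = from-yes (all? λ a → 1₄ *₄ a ≟ a)

*₄-identityʳ : ∀ a → a *₄ 1₄ ≡ a
*₄-identityʳ = from-yes (all? λ a → a *₄ 1₄ ≟ a)

*₄-zeroˡ : ∀ a → 0₄ *₄ a ≡ 0₄
*₄-zeroˡ = from-yes (all? λ a → 0₄ *₄ a ≟ 0₄)

*₄-zeroʳ : ∀ a → a *₄ 0₄ ≡ 0₄
*₄-zeroʳ = from-yes (all? λ a → a *₄ 0₄ ≟ 0₄)

*₄-distribˡ : ∀ a b c → a *₄ (b +₄ c) ≡ (a *₄ b) +₄ (a *₄ c)
*₄-distribˡ = from-yes (all? λ a → all? λ b → all? λ c → a *₄ (b +₄ c) ≟ (a *₄ b) +₄ (a *₄ c))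

*₄-distribʳ : ∀ a b c → (b +₄ c) *₄ a ≡ (b *₄ a) +₄ (c *₄ a)
*₄-distribʳ = from-yes (all? λ a → all? λ b → all? λ c → (b +₄ c) *₄ a ≟ (b *₄ a) +₄ (c *₄ a))

-₄-distrib-+ : ∀ a b → -₄ (a +₄ b) ≡ (-₄ a) +₄ (-₄ b)
-₄-distrib-+ = from-yes (all? λ a → all? λ b → -₄ (a +₄ b) ≟ (-₄ a) +₄ (-₄ b))

-₄-distribʳ-* : ∀ a b → -₄ (a *₄ b) ≡ a *₄ (-₄ b)
-₄-distribʳ-* = from-yes (all? λ a → all? λ b → -₄ (a *₄ b) ≟ a *₄ (-₄ b))

-₄≡-1*₄ : ∀ a → -₄ a ≡ (-₄ 1₄) *₄ a
-₄≡-1*₄ = from-yes (all? λ a → -₄ a ≟ (-₄ 1₄) *₄ a)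

red-+ : ∀ a b → red (a +₄ b) ≡ red a +₂ red b
red-+ = from-yes (all? λ a → all? λ b → red (a +₄ b) ≟ red a +₂ red b)

red-* : ∀ a b → red (a *₄ b) ≡ red a *₂ red b
red-* = from-yes (all? λ a → all? λ b → red (a *₄ b) ≟ red a *₂ red b)

2*≡⇒red≡ : ∀ a b → 2₄ *₄ a ≡ 2₄ *₄ b → red a ≡ red b
2*≡⇒red≡ = from-yes (all? λ a → all? λ b → (2₄ *₄ a ≟ 2₄ *₄ b) →-dec (red a ≟ red b))

red≡⇒2*≡ : ∀ a b → red a ≡ red b → 2₄ *₄ a ≡ 2₄ *₄ b
red≡⇒2*≡ = from-yes (all? λ a → all? λ b → (red a ≟ red b) →-dec (2₄ *₄ a ≟ 2₄ *₄ b))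

2*≡⇒≡+2* : ∀ a b → 2₄ *₄ a ≡ 2₄ *₄ b → Σ Z4 λ w → a ≡ b +₄ (2₄ *₄ w)
2*≡⇒≡+2* = from-yes (all? λ a → all? λ b → (2₄ *₄ a ≟ 2₄ *₄ b) →-dec any? λ w → a ≟ b +₄ (2₄ *₄ w))

2*[a*a]≡2*a : ∀ a → 2₄ *₄ (a *₄ a) ≡ 2₄ *₄ a
2*[a*a]≡2*a = from-yes (all? λ a → 2₄ *₄ (a *₄ a) ≟ 2₄ *₄ a)

+₂-identityˡ : ∀ a → 0₂ +₂ a ≡ a
+₂-identityˡ = from-yes (all? λ a → 0₂ +₂ a ≟ a)

+₂-identityʳ : ∀ a → a +₂ 0₂ ≡ a
+₂-identityʳ = from-yes (all? λ a → a +₂ 0₂ ≟ a)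

*₂-zeroʳ : ∀ a → a *₂ 0₂ ≡ 0₂
*₂-zeroʳ = from-yes (all? λ a → a *₂ 0₂ ≟ 0₂)

+₂-flip : ∀ a b c → a ≡ b +₂ c → b ≡ a +₂ c
+₂-flip = from-yes (all? λ a → all? λ b → all? λ c → (a ≟ b +₂ c) →-dec (b ≟ a +₂ c))

module _ {A B : Set} where

  map-Unique-on : ∀ {g : A → B} {xs} → Unique xs → (∀ {x y} → x ∈ xs → y ∈ xs → g x ≡ g y → x ≡ y)
    → Unique (List.map g xs)
  map-Unique-on {xs = []}     []           _   = []
  map-Unique-on {xs = x ∷ xs} (x∉xs ∷ uxs) inj =
    All.map⁺ (All.tabulate λ y∈xs gx≡gy → All.lookup x∉xs y∈xs (inj (here refl) (there y∈xs) gx≡gy))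
    ∷ map-Unique-on uxs (λ x∈ y∈ → inj (there x∈) (there y∈))

map-↭ : ∀ {A : Set} {g : A → A} {xs} → Unique xs → (∀ {x y} → x ∈ xs → y ∈ xs → g x ≡ g y → x ≡ y)
  → (∀ {x} → x ∈ xs → g x ∈ xs) → (∀ {y} → y ∈ xs → ∃ λ x → x ∈ xs × g x ≡ y)
  → List.map g xs ↭ xs
map-↭ {g = g} {xs} uxs inj into onto =
  ∼bag⇒↭ (unique∧set⇒bag (map-Unique-on uxs inj) uxs (mk⇔ map⊆ ⊆map))
  where
  map⊆ : ∀ {z} → z ∈ List.map g xs → z ∈ xs
  map⊆ z∈ with ∈-map⁻ g z∈
  ... | x , x∈xs , refl = into x∈xs
  ⊆map : ∀ {y} → y ∈ xs → y ∈ List.map g xs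
  ⊆map y∈xs with onto y∈xs
  ... | x , x∈xs , refl = ∈-map⁺ g x∈xs

module ListSum {B : Set} {_∙_ : B → B → B} {ε : B} (isCM : IsCommutativeMonoid _≡_ _∙_ ε) where

  sumOver : {A : Set} → List A → (A → B) → B
  sumOver xs f = List.foldr (λ x acc → f x ∙ acc) ε xs

  sumOver-↭ : ∀ {A : Set} {xs ys : List A} f → xs ↭ ys → sumOver xs f ≡ sumOver ys f
  sumOver-↭ {xs = xs} {ys} f xs↭ys = begin
    sumOver xs f                         ≡⟨ sym (foldr-map _∙_ f ε xs) ⟩
    List.foldr _∙_ ε (List.map f xs)     ≡⟨ foldr-commMonoid isCM (↭⇒↭ₛ (↭-map⁺ f xs↭ys)) ⟩
    List.foldr _∙_ ε (List.map f ys)     ≡⟨ foldr-map _∙_ f ε ys ⟩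
    sumOver ys f                         ∎
    where
    open ≡-Reasoning
    open PermutationProperties (setoid B) using (foldr-commMonoid)

  sumOver-reindex : ∀ {A : Set} {g : A → A} {xs} f → List.map g xs ↭ xs → sumOver xs f ≡ sumOver xs (f ∘ g)
  sumOver-reindex {g = g} {xs} f g[xs]↭xs =
    trans (sym (sumOver-↭ f g[xs]↭xs)) (foldr-map (λ y acc → f y ∙ acc) g ε xs)

  sumOver-cong : ∀ {A : Set} {xs : List A} {f g} → (∀ {x} → x ∈ xs → f x ≡ g x) → sumOver xs f ≡ sumOver xs g
  sumOver-cong {xs = []}     f≗g = refl
  sumOver-cong {xs = x ∷ xs} f≗g = cong₂ _∙_ (f≗g (here refl)) (sumOver-cong (f≗g ∘ there))

+₄-isCommutativeMonoid : IsCommutativeMonoid _≡_ _+₄_ 0₄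
+₄-isCommutativeMonoid = record
  { isMonoid = record
    { isSemigroup = record { isMagma = record { isEquivalence = isEquivalence ; ∙-cong = cong₂ _+₄_ } ; assoc = +₄-assoc }
    ; identity = +₄-identityˡ , +₄-identityʳ }
  ; comm = +₄-comm }

module Sum₄ = ListSum +₄-isCommutativeMonoid

module PolyCoeff {A : Set} (0# 1# : A) (_+_ _*_ : A → A → A) (-_ : A → A)
  (+-identityˡ : ∀ a → 0# + a ≡ a) (+-identityʳ : ∀ a → a + 0# ≡ a) (*-zeroʳ : ∀ a → a * 0# ≡ 0#) where

  open Poly 0# 1# _+_ _*_ -_

  coeff-⊕ : ∀ p q i → coeff (p ⊕ q) i ≡ coeff p i + coeff q i
  coeff-⊕ []      q       i       = sym (+-identityˡ _)
  coeff-⊕ (a ∷ p) []      zero    = sym (+-identityʳ a)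
  coeff-⊕ (a ∷ p) []      (suc i) = sym (+-identityʳ _)
  coeff-⊕ (a ∷ p) (b ∷ q) zero    = refl
  coeff-⊕ (a ∷ p) (b ∷ q) (suc i) = coeff-⊕ p q i

  coeff-scale : ∀ a p i → coeff (scale a p) i ≡ a * coeff p i
  coeff-scale a []      i       = sym (*-zeroʳ a)
  coeff-scale a (b ∷ p) zero    = refl
  coeff-scale a (b ∷ p) (suc i) = coeff-scale a p i

module P4-coeff = PolyCoeff 0₄ 1₄ _+₄_ _*₄_ -₄_ +₄-identityˡ +₄-identityʳ *₄-zeroʳ
module P2-coeff = PolyCoeff 0₂ 1₂ _+₂_ _*₂_ -₂_ +₂-identityˡ +₂-identityʳ *₂-zeroʳ

red-⊕ : ∀ p q → List.map red (p P4.⊕ q) ≡ List.map red p P2.⊕ List.map red q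
red-⊕ []      q       = refl
red-⊕ (a ∷ p) []      = refl
red-⊕ (a ∷ p) (b ∷ q) = cong₂ _∷_ (red-+ a b) (red-⊕ p q)

red-scale : ∀ a p → List.map red (P4.scale a p) ≡ P2.scale (red a) (List.map red p)
red-scale a []      = refl
red-scale a (b ∷ p) = cong₂ _∷_ (red-* a b) (red-scale a p)

red-⊗ : ∀ p q → List.map red (p P4.⊗ q) ≡ List.map red p P2.⊗ List.map red q
red-⊗ []      q = refl
red-⊗ (a ∷ p) q = trans (red-⊕ (P4.scale a q) (0₄ ∷ (p P4.⊗ q)))
                        (cong₂ P2._⊕_ (red-scale a q) (cong (0₂ ∷_) (red-⊗ p q)))

red-coeff : ∀ p i → P2.coeff (List.map red p) i ≡ red (P4.coeff p i)
red-coeff []      i       = refl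
red-coeff (a ∷ p) zero    = refl
red-coeff (a ∷ p) (suc i) = red-coeff p i

red-Xpow : ∀ k → List.map red (P4.Xpow k) ≡ P2.Xpow k
red-Xpow zero    = refl
red-Xpow (suc k) = cong (0₂ ∷_) (red-Xpow k)

infixl 6 _+ᵥ_
infixr 7 _·ᵥ_

_+ᵥ_ : Vec Z4 n → Vec Z4 n → Vec Z4 n
_+ᵥ_ = Vec.zipWith _+₄_

_·ᵥ_ : Z4 → Vec Z4 n → Vec Z4 n
a ·ᵥ v = Vec.map (a *₄_) v

0ᵥ : Vec Z4 n
0ᵥ = Vec.replicate _ 0₄

+ᵥ-assoc : (u v w : Vec Z4 n) → (u +ᵥ v) +ᵥ w ≡ u +ᵥ (v +ᵥ w)
+ᵥ-assoc = VecP.zipWith-assoc +₄-assoc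

+ᵥ-comm : (u v : Vec Z4 n) → u +ᵥ v ≡ v +ᵥ u
+ᵥ-comm = VecP.zipWith-comm +₄-comm

+ᵥ-identityˡ : (u : Vec Z4 n) → 0ᵥ +ᵥ u ≡ u
+ᵥ-identityˡ = VecP.zipWith-identityˡ +₄-identityˡ

+ᵥ-identityʳ : (u : Vec Z4 n) → u +ᵥ 0ᵥ ≡ u
+ᵥ-identityʳ = VecP.zipWith-identityʳ +₄-identityʳ

+ᵥ-interchange : (u v w x : Vec Z4 n) → (u +ᵥ v) +ᵥ (w +ᵥ x) ≡ (u +ᵥ w) +ᵥ (v +ᵥ x)
+ᵥ-interchange u v w x = begin
  (u +ᵥ v) +ᵥ (w +ᵥ x)  ≡⟨ +ᵥ-assoc u v (w +ᵥ x) ⟩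
  u +ᵥ (v +ᵥ (w +ᵥ x))  ≡⟨ cong (u +ᵥ_) (sym (+ᵥ-assoc v w x)) ⟩
  u +ᵥ ((v +ᵥ w) +ᵥ x)  ≡⟨ cong (λ y → u +ᵥ (y +ᵥ x)) (+ᵥ-comm v w) ⟩
  u +ᵥ ((w +ᵥ v) +ᵥ x)  ≡⟨ cong (u +ᵥ_) (+ᵥ-assoc w v x) ⟩
  u +ᵥ (w +ᵥ (v +ᵥ x))  ≡⟨ sym (+ᵥ-assoc u w (v +ᵥ x)) ⟩
  (u +ᵥ w) +ᵥ (v +ᵥ x)  ∎
  where open ≡-Reasoning

·ᵥ-distribˡ : ∀ a (u v : Vec Z4 n) → a ·ᵥ (u +ᵥ v) ≡ a ·ᵥ u +ᵥ a ·ᵥ v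
·ᵥ-distribˡ a []      []      = refl
·ᵥ-distribˡ a (b ∷ u) (c ∷ v) = cong₂ _∷_ (*₄-distribˡ a b c) (·ᵥ-distribˡ a u v)

·ᵥ-distribʳ : ∀ a b (u : Vec Z4 n) → (a +₄ b) ·ᵥ u ≡ a ·ᵥ u +ᵥ b ·ᵥ u
·ᵥ-distribʳ a b []      = refl
·ᵥ-distribʳ a b (c ∷ u) = cong₂ _∷_ (*₄-distribʳ c a b) (·ᵥ-distribʳ a b u)

·ᵥ-assoc : ∀ a b (u : Vec Z4 n) → (a *₄ b) ·ᵥ u ≡ a ·ᵥ (b ·ᵥ u)
·ᵥ-assoc a b u = trans (VecP.map-cong (*₄-assoc a b) u) (VecP.map-∘ (a *₄_) (b *₄_) u)

·ᵥ-identity : (u : Vec Z4 n) → 1₄ ·ᵥ u ≡ u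
·ᵥ-identity u = trans (VecP.map-cong *₄-identityˡ u) (VecP.map-id u)

·ᵥ-zeroˡ : (u : Vec Z4 n) → 0₄ ·ᵥ u ≡ 0ᵥ
·ᵥ-zeroˡ u = trans (VecP.map-cong *₄-zeroˡ u) (VecP.map-const u 0₄)

·ᵥ-zeroʳ : ∀ a → a ·ᵥ 0ᵥ {n} ≡ 0ᵥ
·ᵥ-zeroʳ {n} a = trans (VecP.map-replicate (a *₄_) 0₄ n) (cong (Vec.replicate n) (*₄-zeroʳ a))

-1·ᵥ-inverseˡ : (u : Vec Z4 n) → (-₄ 1₄) ·ᵥ u +ᵥ u ≡ 0ᵥ
-1·ᵥ-inverseˡ u = begin
  (-₄ 1₄) ·ᵥ u +ᵥ u        ≡⟨ cong ((-₄ 1₄) ·ᵥ u +ᵥ_) (sym (·ᵥ-identity u)) ⟩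
  (-₄ 1₄) ·ᵥ u +ᵥ 1₄ ·ᵥ u  ≡⟨ sym (·ᵥ-distribʳ (-₄ 1₄) 1₄ u) ⟩
  0₄ ·ᵥ u                  ≡⟨ ·ᵥ-zeroˡ u ⟩
  0ᵥ                       ∎
  where open ≡-Reasoning

shiftIn-+ : ∀ (u v : Vec Z4 n) a b → shiftIn (u +ᵥ v) (a +₄ b)
  ≡ (proj₁ (shiftIn u a) +ᵥ proj₁ (shiftIn v b) , proj₂ (shiftIn u a) +₄ proj₂ (shiftIn v b))
shiftIn-+ []      []      a b = refl
shiftIn-+ (x ∷ u) (y ∷ v) a b rewrite shiftIn-+ u v x y = refl

shiftIn-· : ∀ (u : Vec Z4 n) c a →
  shiftIn (c ·ᵥ u) (c *₄ a) ≡ (c ·ᵥ proj₁ (shiftIn u a) , c *₄ proj₂ (shiftIn u a))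
shiftIn-· []      c a = refl
shiftIn-· (x ∷ u) c a rewrite shiftIn-· u c x = refl

shiftIn-0 : shiftIn (0ᵥ {n}) 0₄ ≡ (0ᵥ , 0₄)
shiftIn-0 {zero}  = refl
shiftIn-0 {suc n} rewrite shiftIn-0 {n} = refl

shiftIn-toList : ∀ (v : Vec Z4 n) a →
  Vec.toList (proj₁ (shiftIn v a)) ++ [ proj₂ (shiftIn v a) ] ≡ a ∷ Vec.toList v
shiftIn-toList []      a = refl
shiftIn-toList (x ∷ v) a with shiftIn v x | shiftIn-toList v x
... | ys , l | eq = cong (a ∷_) eq

pad : (n : ℕ) → List Z4 → Vec Z4 n
pad zero    _       = []
pad (suc n) []      = 0₄ ∷ pad n []
pad (suc n) (a ∷ p) = a ∷ pad n p

pad-[] : pad n [] ≡ 0ᵥ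
pad-[] {zero}  = refl
pad-[] {suc n} = cong (0₄ ∷_) pad-[]

pad-toList : (v : Vec Z4 n) → pad n (Vec.toList v) ≡ v
pad-toList []      = refl
pad-toList (x ∷ v) = cong (x ∷_) (pad-toList v)

shiftIn-pad : ∀ n p a → List.length p < n → shiftIn (pad n p) a ≡ (pad n (a ∷ p) , 0₄)
shiftIn-pad (suc n) []      a _ rewrite pad-[] {n} | shiftIn-0 {n} = refl
shiftIn-pad (suc n) (b ∷ p) a (s≤s lt) rewrite shiftIn-pad n p b lt = refl

shiftIn-pad-Xpow : ∀ k a → shiftIn (pad (suc k) (P4.Xpow k)) a ≡ (pad (suc k) [ a ] , 1₄)
shiftIn-pad-Xpow zero    a = refl
shiftIn-pad-Xpow (suc k) a rewrite shiftIn-pad-Xpow k 0₄ = refl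

length-Xpow : ∀ k → List.length (P4.Xpow k) ≡ suc k
length-Xpow zero    = refl
length-Xpow (suc k) = cong suc (length-Xpow k)

2·≡⇒≡+2· : ∀ (x y : Vec Z4 n) → 2₄ ·ᵥ x ≡ 2₄ ·ᵥ y → Σ (Vec Z4 n) λ w → x ≡ y +ᵥ 2₄ ·ᵥ w
2·≡⇒≡+2· []      []      _ = [] , refl
2·≡⇒≡+2· (a ∷ x) (b ∷ y) e with 2*≡⇒≡+2* a b (VecP.∷-injectiveˡ e) | 2·≡⇒≡+2· x y (VecP.∷-injectiveʳ e)
... | w , a≡b+2w | ws , x≡y+2ws = w ∷ ws , cong₂ _∷_ a≡b+2w x≡y+2ws

2·≡⇒red-coeff≡ : ∀ (x y : Vec Z4 n) → 2₄ ·ᵥ x ≡ 2₄ ·ᵥ y →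
  ∀ i → red (P4.coeff (Vec.toList x) i) ≡ red (P4.coeff (Vec.toList y) i)
2·≡⇒red-coeff≡ []      []      e i       = refl
2·≡⇒red-coeff≡ (a ∷ x) (b ∷ y) e zero    = 2*≡⇒red≡ a b (VecP.∷-injectiveˡ e)
2·≡⇒red-coeff≡ (a ∷ x) (b ∷ y) e (suc i) = 2·≡⇒red-coeff≡ x y (VecP.∷-injectiveʳ e) i

code : Vec Z4 n → Fin (2 ^ n)
code []      = Fin.zero
code (a ∷ v) = Fin.combine (red a) (code v)

code≡⇒2·≡ : ∀ (x y : Vec Z4 n) → code x ≡ code y → 2₄ ·ᵥ x ≡ 2₄ ·ᵥ y
code≡⇒2·≡ []      []      _ = refl
code≡⇒2·≡ {suc n} (a ∷ x) (b ∷ y) e = cong₂ _∷_ (red≡⇒2*≡ a b (cong proj₁ parts)) (code≡⇒2·≡ x y (cong proj₂ parts))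
  where
  parts : (red a , code x) ≡ (red b , code y)
  parts = begin
    (red a , code x)                                ≡⟨ sym (FinP.remQuot-combine (red a) (code x)) ⟩
    Fin.remQuot (2 ^ n) (Fin.combine (red a) (code x)) ≡⟨ cong (Fin.remQuot (2 ^ n)) e ⟩
    Fin.remQuot (2 ^ n) (Fin.combine (red b) (code y)) ≡⟨ FinP.remQuot-combine (red b) (code y) ⟩
    (red b , code y)                                ∎
    where open ≡-Reasoning

coeff-snoc : ∀ (s h : Vec Z4 n) l i → P4.coeff (Vec.toList s ++ [ l ]) i
  ≡ (l *₄ P4.coeff (Vec.toList h ++ [ 1₄ ]) i) +₄ P4.coeff (Vec.toList (s +ᵥ (-₄ l) ·ᵥ h)) i
coeff-snoc []      []      l zero    = from-yes (all? λ l → l ≟ (l *₄ 1₄) +₄ 0₄) l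
coeff-snoc []      []      l (suc i) = from-yes (all? λ l → 0₄ ≟ (l *₄ 0₄) +₄ 0₄) l
coeff-snoc (a ∷ s) (b ∷ h) l zero    =
  from-yes (all? λ a → all? λ b → all? λ l → a ≟ (l *₄ b) +₄ (a +₄ ((-₄ l) *₄ b))) a b l
coeff-snoc (a ∷ s) (b ∷ h) l (suc i) = coeff-snoc s h l i

coeff-0ᵥ : ∀ i → P4.coeff (Vec.toList (0ᵥ {n})) i ≡ 0₄
coeff-0ᵥ {zero}  i       = refl
coeff-0ᵥ {suc n} zero    = refl
coeff-0ᵥ {suc n} (suc i) = coeff-0ᵥ {n} i

Z4-rawRing : RawRing 0ℓ 0ℓ
Z4-rawRing = record
  { Carrier = Z4 ; _≈_ = _≡_ ; _+_ = _+₄_ ; _*_ = _*₄_ ; -_ = -₄_ ; 0# = 0₄ ; 1# = 1₄ }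

-- The Galois ring R = ℤ₄[X]/(h)

module GaloisRing (n : ℕ) (hc : Vec Z4 (suc n)) where

  open GR (suc n) hc public

  private
    m : ℕ
    m = suc n

  -- s + l·X^m reduced modulo h, using X^m ≡ -hc.
  reduce : R × Z4 → R
  reduce (s , l) = s +ᵥ (-₄ l) ·ᵥ hc

  ξ*≡reduce∘shiftIn : ∀ v → ξ* v ≡ reduce (shiftIn v 0₄)
  ξ*≡reduce∘shiftIn v with shiftIn v 0₄
  ... | s , l = refl

  reduce-+ : ∀ s s′ l l′ → reduce (s +ᵥ s′ , l +₄ l′) ≡ reduce (s , l) +ᵥ reduce (s′ , l′)
  reduce-+ s s′ l l′ = begin
    (s +ᵥ s′) +ᵥ (-₄ (l +₄ l′)) ·ᵥ hc               ≡⟨ cong (λ a → (s +ᵥ s′) +ᵥ a ·ᵥ hc) (-₄-distrib-+ l l′) ⟩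
    (s +ᵥ s′) +ᵥ ((-₄ l) +₄ (-₄ l′)) ·ᵥ hc          ≡⟨ cong ((s +ᵥ s′) +ᵥ_) (·ᵥ-distribʳ (-₄ l) (-₄ l′) hc) ⟩
    (s +ᵥ s′) +ᵥ ((-₄ l) ·ᵥ hc +ᵥ (-₄ l′) ·ᵥ hc)    ≡⟨ +ᵥ-interchange s s′ _ _ ⟩
    (s +ᵥ (-₄ l) ·ᵥ hc) +ᵥ (s′ +ᵥ (-₄ l′) ·ᵥ hc)    ∎
    where open ≡-Reasoning

  reduce-· : ∀ c s l → reduce (c ·ᵥ s , c *₄ l) ≡ c ·ᵥ reduce (s , l)
  reduce-· c s l = begin
    c ·ᵥ s +ᵥ (-₄ (c *₄ l)) ·ᵥ hc      ≡⟨ cong (λ a → c ·ᵥ s +ᵥ a ·ᵥ hc) (-₄-distribʳ-* c l) ⟩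
    c ·ᵥ s +ᵥ (c *₄ (-₄ l)) ·ᵥ hc      ≡⟨ cong (c ·ᵥ s +ᵥ_) (·ᵥ-assoc c (-₄ l) hc) ⟩
    c ·ᵥ s +ᵥ c ·ᵥ ((-₄ l) ·ᵥ hc)      ≡⟨ sym (·ᵥ-distribˡ c s _) ⟩
    c ·ᵥ (s +ᵥ (-₄ l) ·ᵥ hc)           ∎
    where open ≡-Reasoning

  ξ*-+ : ∀ u v → ξ* (u +ᵥ v) ≡ ξ* u +ᵥ ξ* v
  ξ*-+ u v = begin
    ξ* (u +ᵥ v)                                   ≡⟨ ξ*≡reduce∘shiftIn (u +ᵥ v) ⟩
    reduce (shiftIn (u +ᵥ v) (0₄ +₄ 0₄))          ≡⟨ cong reduce (shiftIn-+ u v 0₄ 0₄) ⟩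
    reduce (su +ᵥ sv , lu +₄ lv)                  ≡⟨ reduce-+ su sv lu lv ⟩
    reduce (shiftIn u 0₄) +ᵥ reduce (shiftIn v 0₄) ≡⟨ sym (cong₂ _+ᵥ_ (ξ*≡reduce∘shiftIn u) (ξ*≡reduce∘shiftIn v)) ⟩
    ξ* u +ᵥ ξ* v                                  ∎
    where
    open ≡-Reasoning
    su = proj₁ (shiftIn u 0₄); lu = proj₂ (shiftIn u 0₄)
    sv = proj₁ (shiftIn v 0₄); lv = proj₂ (shiftIn v 0₄)

  ξ*-· : ∀ c u → ξ* (c ·ᵥ u) ≡ c ·ᵥ ξ* u
  ξ*-· c u = begin
    ξ* (c ·ᵥ u)                         ≡⟨ ξ*≡reduce∘shiftIn (c ·ᵥ u) ⟩
    reduce (shiftIn (c ·ᵥ u) 0₄)        ≡⟨ cong (λ a → reduce (shiftIn (c ·ᵥ u) a)) (sym (*₄-zeroʳ c)) ⟩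
    reduce (shiftIn (c ·ᵥ u) (c *₄ 0₄)) ≡⟨ cong reduce (shiftIn-· u c 0₄) ⟩
    reduce (c ·ᵥ s , c *₄ l)            ≡⟨ reduce-· c s l ⟩
    c ·ᵥ reduce (shiftIn u 0₄)          ≡⟨ cong (c ·ᵥ_) (sym (ξ*≡reduce∘shiftIn u)) ⟩
    c ·ᵥ ξ* u                           ∎
    where
    open ≡-Reasoning
    s = proj₁ (shiftIn u 0₄); l = proj₂ (shiftIn u 0₄)

  ξ*-0 : ξ* 0R ≡ 0R
  ξ*-0 = begin
    ξ* 0R                  ≡⟨ ξ*≡reduce∘shiftIn 0R ⟩
    reduce (shiftIn 0R 0₄) ≡⟨ cong reduce shiftIn-0 ⟩
    0R +ᵥ 0₄ ·ᵥ hc         ≡⟨ +ᵥ-identityˡ _ ⟩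
    0₄ ·ᵥ hc               ≡⟨ ·ᵥ-zeroˡ hc ⟩
    0R                     ∎
    where open ≡-Reasoning

  mulL-+ : ∀ ℓ u v → mulL ℓ (u +ᵥ v) ≡ mulL ℓ u +ᵥ mulL ℓ v
  mulL-+ []      u v = sym (+ᵥ-identityˡ 0R)
  mulL-+ (a ∷ ℓ) u v = begin
    a ·ᵥ (u +ᵥ v) +ᵥ mulL ℓ (ξ* (u +ᵥ v))
      ≡⟨ cong₂ _+ᵥ_ (·ᵥ-distribˡ a u v) (trans (cong (mulL ℓ) (ξ*-+ u v)) (mulL-+ ℓ (ξ* u) (ξ* v))) ⟩
    (a ·ᵥ u +ᵥ a ·ᵥ v) +ᵥ (mulL ℓ (ξ* u) +ᵥ mulL ℓ (ξ* v))
      ≡⟨ +ᵥ-interchange _ _ _ _ ⟩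
    (a ·ᵥ u +ᵥ mulL ℓ (ξ* u)) +ᵥ (a ·ᵥ v +ᵥ mulL ℓ (ξ* v)) ∎
    where open ≡-Reasoning

  mulL-· : ∀ ℓ c u → mulL ℓ (c ·ᵥ u) ≡ c ·ᵥ mulL ℓ u
  mulL-· []      c u = sym (·ᵥ-zeroʳ c)
  mulL-· (a ∷ ℓ) c u = begin
    a ·ᵥ (c ·ᵥ u) +ᵥ mulL ℓ (ξ* (c ·ᵥ u))
      ≡⟨ cong₂ _+ᵥ_ (sym (·ᵥ-assoc a c u)) (trans (cong (mulL ℓ) (ξ*-· c u)) (mulL-· ℓ c (ξ* u))) ⟩
    (a *₄ c) ·ᵥ u +ᵥ c ·ᵥ mulL ℓ (ξ* u)
      ≡⟨ cong (λ b → b ·ᵥ u +ᵥ c ·ᵥ mulL ℓ (ξ* u)) (*₄-comm a c) ⟩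
    (c *₄ a) ·ᵥ u +ᵥ c ·ᵥ mulL ℓ (ξ* u)
      ≡⟨ cong (_+ᵥ c ·ᵥ mulL ℓ (ξ* u)) (·ᵥ-assoc c a u) ⟩
    c ·ᵥ (a ·ᵥ u) +ᵥ c ·ᵥ mulL ℓ (ξ* u)
      ≡⟨ sym (·ᵥ-distribˡ c _ _) ⟩
    c ·ᵥ (a ·ᵥ u +ᵥ mulL ℓ (ξ* u)) ∎
    where open ≡-Reasoning

  mulL-ξ* : ∀ ℓ u → mulL ℓ (ξ* u) ≡ ξ* (mulL ℓ u)
  mulL-ξ* []      u = sym ξ*-0
  mulL-ξ* (a ∷ ℓ) u = begin
    a ·ᵥ ξ* u +ᵥ mulL ℓ (ξ* (ξ* u))      ≡⟨ cong₂ _+ᵥ_ (sym (ξ*-· a u)) (mulL-ξ* ℓ (ξ* u)) ⟩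
    ξ* (a ·ᵥ u) +ᵥ ξ* (mulL ℓ (ξ* u))    ≡⟨ sym (ξ*-+ (a ·ᵥ u) (mulL ℓ (ξ* u))) ⟩
    ξ* (a ·ᵥ u +ᵥ mulL ℓ (ξ* u))         ∎
    where open ≡-Reasoning

  mulL-comm : ∀ ℓ ℓ′ u → mulL ℓ (mulL ℓ′ u) ≡ mulL ℓ′ (mulL ℓ u)
  mulL-comm ℓ []       u = begin
    mulL ℓ 0R          ≡⟨ cong (mulL ℓ) (sym (·ᵥ-zeroˡ u)) ⟩
    mulL ℓ (0₄ ·ᵥ u)    ≡⟨ mulL-· ℓ 0₄ u ⟩
    0₄ ·ᵥ mulL ℓ u      ≡⟨ ·ᵥ-zeroˡ _ ⟩
    0R                 ∎
    where open ≡-Reasoning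
  mulL-comm ℓ (a ∷ ℓ′) u = begin
    mulL ℓ (a ·ᵥ u +ᵥ mulL ℓ′ (ξ* u))             ≡⟨ mulL-+ ℓ _ _ ⟩
    mulL ℓ (a ·ᵥ u) +ᵥ mulL ℓ (mulL ℓ′ (ξ* u))    ≡⟨ cong₂ _+ᵥ_ (mulL-· ℓ a u) (mulL-comm ℓ ℓ′ (ξ* u)) ⟩
    a ·ᵥ mulL ℓ u +ᵥ mulL ℓ′ (mulL ℓ (ξ* u))      ≡⟨ cong (λ z → a ·ᵥ mulL ℓ u +ᵥ mulL ℓ′ z) (mulL-ξ* ℓ u) ⟩
    a ·ᵥ mulL ℓ u +ᵥ mulL ℓ′ (ξ* (mulL ℓ u))      ∎
    where open ≡-Reasoning

  eval : P4.Pol → R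
  eval p = mulL p 1R

  eval-∷ : ∀ a p → eval (a ∷ p) ≡ a ·ᵥ 1R +ᵥ ξ* (eval p)
  eval-∷ a p = cong (a ·ᵥ 1R +ᵥ_) (mulL-ξ* p 1R)

  eval-pad : ∀ p → List.length p ≤ m → eval p ≡ pad m p
  eval-pad []      _  = sym pad-[]
  eval-pad (a ∷ p) le = begin
    eval (a ∷ p)                   ≡⟨ eval-∷ a p ⟩
    a ·ᵥ 1R +ᵥ ξ* (eval p)          ≡⟨ cong (λ z → a ·ᵥ 1R +ᵥ ξ* z) (eval-pad p (ℕP.≤-trans (ℕP.n≤1+n _) le)) ⟩
    a ·ᵥ 1R +ᵥ ξ* (pad m p)         ≡⟨ cong (a ·ᵥ 1R +ᵥ_) ξ*-pad ⟩
    a ·ᵥ 1R +ᵥ pad m (0₄ ∷ p)       ≡⟨ cong₂ _∷_ (trans (+₄-identityʳ _) (*₄-identityʳ a))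
                                               (trans (cong (_+ᵥ pad n p) (·ᵥ-zeroʳ a)) (+ᵥ-identityˡ (pad n p))) ⟩
    pad m (a ∷ p)                  ∎
    where
    open ≡-Reasoning
    ξ*-pad : ξ* (pad m p) ≡ pad m (0₄ ∷ p)
    ξ*-pad = begin
      ξ* (pad m p)                   ≡⟨ ξ*≡reduce∘shiftIn (pad m p) ⟩
      reduce (shiftIn (pad m p) 0₄)  ≡⟨ cong reduce (shiftIn-pad m p 0₄ le) ⟩
      pad m (0₄ ∷ p) +ᵥ 0₄ ·ᵥ hc     ≡⟨ cong (pad m (0₄ ∷ p) +ᵥ_) (·ᵥ-zeroˡ hc) ⟩
      pad m (0₄ ∷ p) +ᵥ 0R           ≡⟨ +ᵥ-identityʳ _ ⟩
      pad m (0₄ ∷ p)                 ∎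

  *R-identityʳ : ∀ x → x *R 1R ≡ x
  *R-identityʳ x = begin
    eval (Vec.toList x)       ≡⟨ eval-pad (Vec.toList x) (ℕP.≤-reflexive (VecP.length-toList x)) ⟩
    pad m (Vec.toList x)      ≡⟨ pad-toList x ⟩
    x                         ∎
    where open ≡-Reasoning

  *R-comm : ∀ x y → x *R y ≡ y *R x
  *R-comm x y = begin
    mulL (Vec.toList x) y                                ≡⟨ cong (mulL (Vec.toList x)) (sym (*R-identityʳ y)) ⟩
    mulL (Vec.toList x) (mulL (Vec.toList y) 1R)         ≡⟨ mulL-comm (Vec.toList x) (Vec.toList y) 1R ⟩
    mulL (Vec.toList y) (mulL (Vec.toList x) 1R)         ≡⟨ cong (mulL (Vec.toList y)) (*R-identityʳ x) ⟩
    mulL (Vec.toList y) x                                ∎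
    where open ≡-Reasoning

  *R-assoc : ∀ x y z → (x *R y) *R z ≡ x *R (y *R z)
  *R-assoc x y z = begin
    (x *R y) *R z   ≡⟨ *R-comm (x *R y) z ⟩
    z *R (x *R y)   ≡⟨ mulL-comm (Vec.toList z) (Vec.toList x) y ⟩
    x *R (z *R y)   ≡⟨ cong (x *R_) (*R-comm z y) ⟩
    x *R (y *R z)   ∎
    where open ≡-Reasoning

  ring : CommutativeRing 0ℓ 0ℓ
  ring = record
    { Carrier = R ; _≈_ = _≡_ ; _+_ = _+ᵥ_ ; _*_ = _*R_ ; -_ = (-₄ 1₄) ·ᵥ_ ; 0# = 0R ; 1# = 1R
    ; isCommutativeRing = record
      { isRing = record
        { +-isAbelianGroup = record
          { isGroup = record
            { isMonoid = record
              { isSemigroup = record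
                { isMagma = record { isEquivalence = isEquivalence ; ∙-cong = cong₂ _+ᵥ_ }
                ; assoc = +ᵥ-assoc }
              ; identity = +ᵥ-identityˡ , +ᵥ-identityʳ }
            ; inverse = -1·ᵥ-inverseˡ , λ x → trans (+ᵥ-comm x _) (-1·ᵥ-inverseˡ x)
            ; ⁻¹-cong = cong ((-₄ 1₄) ·ᵥ_) }
          ; comm = +ᵥ-comm }
        ; *-cong = cong₂ _*R_
        ; *-assoc = *R-assoc
        ; *-identity = (λ x → trans (*R-comm 1R x) (*R-identityʳ x)) , *R-identityʳ
        ; distrib = (λ x y z → mulL-+ (Vec.toList x) y z)
                  , (λ x y z → trans (*R-comm _ x)
                       (trans (mulL-+ (Vec.toList x) y z) (cong₂ _+ᵥ_ (*R-comm x y) (*R-comm x z)))) }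
      ; *-comm = *R-comm } }

  open CommutativeRing ring public
    using (_+_; _*_; -_; _-_; +-identityˡ; +-identityʳ; *-identityˡ; *-identityʳ; -‿inverseʳ; zeroˡ; zeroʳ)

  ⟦_⟧ : Z4 → R
  ⟦ a ⟧ = a ·ᵥ 1R

  ·-*ˡ : ∀ c x y → (c ·ᵥ x) * y ≡ c ·ᵥ (x * y)
  ·-*ˡ c x y = trans (*R-comm _ y) (trans (mulL-· (Vec.toList y) c x) (cong (c ·ᵥ_) (*R-comm y x)))

  ·-*ʳ : ∀ c x y → x * (c ·ᵥ y) ≡ c ·ᵥ (x * y)
  ·-*ʳ c x y = mulL-· (Vec.toList x) c y

  ·≡⟦⟧* : ∀ c x → c ·ᵥ x ≡ ⟦ c ⟧ * x
  ·≡⟦⟧* c x = sym (trans (·-*ˡ c 1R x) (cong (c ·ᵥ_) (*-identityˡ x)))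

  ξ-*≡ξ* : ∀ x → ξ * x ≡ ξ* x
  ξ-*≡ξ* x = trans (*R-comm ξ x) (trans (mulL-ξ* (Vec.toList x) 1R) (cong ξ* (*R-identityʳ x)))

  ⟦⟧-0 : ⟦ 0₄ ⟧ ≡ 0R
  ⟦⟧-0 = ·ᵥ-zeroˡ 1R

  ⟦⟧-1 : ⟦ 1₄ ⟧ ≡ 1R
  ⟦⟧-1 = ·ᵥ-identity 1R

  ⟦⟧-+ : ∀ a b → ⟦ a +₄ b ⟧ ≡ ⟦ a ⟧ + ⟦ b ⟧
  ⟦⟧-+ a b = ·ᵥ-distribʳ a b 1R

  ⟦⟧-* : ∀ a b → ⟦ a *₄ b ⟧ ≡ ⟦ a ⟧ * ⟦ b ⟧
  ⟦⟧-* a b = trans (·ᵥ-assoc a b 1R) (·≡⟦⟧* a ⟦ b ⟧)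

  ⟦⟧-neg : ∀ a → ⟦ -₄ a ⟧ ≡ - ⟦ a ⟧
  ⟦⟧-neg a = trans (cong (_·ᵥ 1R) (-₄≡-1*₄ a)) (·ᵥ-assoc (-₄ 1₄) a 1R)

  ⟦⟧-morphism : Z4-rawRing -Raw-AlmostCommutative⟶ fromCommutativeRing ring
  ⟦⟧-morphism = record
    { ⟦_⟧ = ⟦_⟧ ; +-homo = ⟦⟧-+ ; *-homo = ⟦⟧-* ; -‿homo = ⟦⟧-neg ; 0-homo = ⟦⟧-0 ; 1-homo = ⟦⟧-1 }

  -- Constants are taken in ℤ₄, so the solver knows that 2 + 2 = 0.
  open RingSolver Z4-rawRing (fromCommutativeRing ring) ⟦⟧-morphism
    (λ a b → Maybe.map (cong ⟦_⟧) (dec⇒maybe (a ≟ b)))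
    public using (solve; _:+_; _:*_; _:-_; con; _:=_)

  eval-horner : ∀ a p → eval (a ∷ p) ≡ ⟦ a ⟧ + ξ * eval p
  eval-horner a p = trans (eval-∷ a p) (cong (⟦ a ⟧ +_) (sym (ξ-*≡ξ* (eval p))))

  eval-const : ∀ a → eval [ a ] ≡ ⟦ a ⟧
  eval-const a = trans (eval-horner a []) (trans (cong (⟦ a ⟧ +_) (zeroʳ ξ)) (+-identityʳ ⟦ a ⟧))

  eval-⊕ : ∀ p q → eval (p P4.⊕ q) ≡ eval p + eval q
  eval-⊕ []      q       = sym (+-identityˡ _)
  eval-⊕ (a ∷ p) []      = sym (+-identityʳ _)
  eval-⊕ (a ∷ p) (b ∷ q) = begin
    eval ((a +₄ b) ∷ (p P4.⊕ q))               ≡⟨ eval-horner (a +₄ b) (p P4.⊕ q) ⟩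
    ⟦ a +₄ b ⟧ + ξ * eval (p P4.⊕ q)           ≡⟨ cong₂ (λ c e → c + ξ * e) (⟦⟧-+ a b) (eval-⊕ p q) ⟩
    (⟦ a ⟧ + ⟦ b ⟧) + ξ * (eval p + eval q)    ≡⟨ solve 5 (λ A B X P Q → (A :+ B) :+ X :* (P :+ Q) := (A :+ X :* P) :+ (B :+ X :* Q))
                                                        refl ⟦ a ⟧ ⟦ b ⟧ ξ (eval p) (eval q) ⟩
    (⟦ a ⟧ + ξ * eval p) + (⟦ b ⟧ + ξ * eval q) ≡⟨ sym (cong₂ _+_ (eval-horner a p) (eval-horner b q)) ⟩
    eval (a ∷ p) + eval (b ∷ q)                ∎
    where open ≡-Reasoning

  eval-scale : ∀ a p → eval (P4.scale a p) ≡ ⟦ a ⟧ * eval p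
  eval-scale a []      = sym (zeroʳ ⟦ a ⟧)
  eval-scale a (b ∷ p) = begin
    eval ((a *₄ b) ∷ P4.scale a p)          ≡⟨ eval-horner (a *₄ b) (P4.scale a p) ⟩
    ⟦ a *₄ b ⟧ + ξ * eval (P4.scale a p)    ≡⟨ cong₂ (λ c e → c + ξ * e) (⟦⟧-* a b) (eval-scale a p) ⟩
    ⟦ a ⟧ * ⟦ b ⟧ + ξ * (⟦ a ⟧ * eval p)    ≡⟨ solve 4 (λ A B X P → A :* B :+ X :* (A :* P) := A :* (B :+ X :* P))
                                                     refl ⟦ a ⟧ ⟦ b ⟧ ξ (eval p) ⟩
    ⟦ a ⟧ * (⟦ b ⟧ + ξ * eval p)            ≡⟨ cong (⟦ a ⟧ *_) (sym (eval-horner b p)) ⟩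
    ⟦ a ⟧ * eval (b ∷ p)                    ∎
    where open ≡-Reasoning

  eval-⊗ : ∀ p q → eval (p P4.⊗ q) ≡ eval p * eval q
  eval-⊗ []      q = sym (zeroˡ (eval q))
  eval-⊗ (a ∷ p) q = begin
    eval (P4.scale a q P4.⊕ (0₄ ∷ (p P4.⊗ q)))        ≡⟨ eval-⊕ (P4.scale a q) (0₄ ∷ (p P4.⊗ q)) ⟩
    eval (P4.scale a q) + eval (0₄ ∷ (p P4.⊗ q))      ≡⟨ cong₂ _+_ (eval-scale a q) (eval-horner 0₄ (p P4.⊗ q)) ⟩
    ⟦ a ⟧ * eval q + (⟦ 0₄ ⟧ + ξ * eval (p P4.⊗ q))   ≡⟨ cong (λ e → ⟦ a ⟧ * eval q + (⟦ 0₄ ⟧ + ξ * e)) (eval-⊗ p q) ⟩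
    ⟦ a ⟧ * eval q + (⟦ 0₄ ⟧ + ξ * (eval p * eval q)) ≡⟨ solve 4 (λ A Q P X → A :* Q :+ (con 0₄ :+ X :* (P :* Q)) := (A :+ X :* P) :* Q)
                                                            refl ⟦ a ⟧ (eval q) (eval p) ξ ⟩
    (⟦ a ⟧ + ξ * eval p) * eval q                     ≡⟨ cong (_* eval q) (sym (eval-horner a p)) ⟩
    eval (a ∷ p) * eval q                             ∎
    where open ≡-Reasoning

  eval-++ : ∀ p q → eval (p ++ q) ≡ eval p + ξ ^R List.length p * eval q
  eval-++ []      q = sym (trans (+-identityˡ _) (*-identityˡ _))
  eval-++ (a ∷ p) q = begin
    eval (a ∷ (p ++ q))                                ≡⟨ eval-horner a (p ++ q) ⟩
    ⟦ a ⟧ + ξ * eval (p ++ q)                          ≡⟨ cong (λ e → ⟦ a ⟧ + ξ * e) (eval-++ p q) ⟩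
    ⟦ a ⟧ + ξ * (eval p + ξ ^R List.length p * eval q) ≡⟨ solve 5 (λ A X P Y Q → A :+ X :* (P :+ Y :* Q) := (A :+ X :* P) :+ (X :* Y) :* Q)
                                                             refl ⟦ a ⟧ ξ (eval p) (ξ ^R List.length p) (eval q) ⟩
    (⟦ a ⟧ + ξ * eval p) + ξ ^R suc (List.length p) * eval q ≡⟨ cong (_+ ξ ^R suc (List.length p) * eval q) (sym (eval-horner a p)) ⟩
    eval (a ∷ p) + ξ ^R suc (List.length p) * eval q   ∎
    where open ≡-Reasoning

  eval-zero : ∀ p → (∀ i → P4.coeff p i ≡ 0₄) → eval p ≡ 0R
  eval-zero []      _ = refl
  eval-zero (a ∷ p) z = begin
    eval (a ∷ p)         ≡⟨ eval-horner a p ⟩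
    ⟦ a ⟧ + ξ * eval p   ≡⟨ cong₂ (λ c r → ⟦ c ⟧ + ξ * r) (z 0) (eval-zero p (λ i → z (suc i))) ⟩
    ⟦ 0₄ ⟧ + ξ * 0R      ≡⟨ cong₂ _+_ ⟦⟧-0 (zeroʳ ξ) ⟩
    0R + 0R              ≡⟨ +-identityˡ 0R ⟩
    0R                   ∎
    where open ≡-Reasoning

  eval-≈ : ∀ p q → p P4.≈ q → eval p ≡ eval q
  eval-≈ []      q       e = sym (eval-zero q (λ i → sym (e i)))
  eval-≈ (a ∷ p) []      e = eval-zero (a ∷ p) e
  eval-≈ (a ∷ p) (b ∷ q) e = begin
    eval (a ∷ p)         ≡⟨ eval-horner a p ⟩
    ⟦ a ⟧ + ξ * eval p   ≡⟨ cong₂ (λ c r → ⟦ c ⟧ + ξ * r) (e 0) (eval-≈ p q (λ i → e (suc i))) ⟩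
    ⟦ b ⟧ + ξ * eval q   ≡⟨ sym (eval-horner b q) ⟩
    eval (b ∷ q)         ∎
    where open ≡-Reasoning

  eval-Xpow : ∀ k → eval (P4.Xpow k) ≡ ξ ^R k
  eval-Xpow zero    = trans (eval-const 1₄) ⟦⟧-1
  eval-Xpow (suc k) = begin
    eval (0₄ ∷ P4.Xpow k)        ≡⟨ eval-horner 0₄ (P4.Xpow k) ⟩
    ⟦ 0₄ ⟧ + ξ * eval (P4.Xpow k) ≡⟨ cong₂ (λ c e → c + ξ * e) ⟦⟧-0 (eval-Xpow k) ⟩
    0R + ξ * ξ ^R k              ≡⟨ +-identityˡ _ ⟩
    ξ ^R suc k                   ∎
    where open ≡-Reasoning

  ξ^m≡-hc : ξ ^R m ≡ - hc
  ξ^m≡-hc = begin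
    ξ * ξ ^R n                                  ≡⟨ ξ-*≡ξ* (ξ ^R n) ⟩
    ξ* (ξ ^R n)                                 ≡⟨ cong ξ* ξ^n≡pad ⟩
    ξ* (pad m (P4.Xpow n))                      ≡⟨ ξ*≡reduce∘shiftIn (pad m (P4.Xpow n)) ⟩
    reduce (shiftIn (pad m (P4.Xpow n)) 0₄)     ≡⟨ cong reduce (shiftIn-pad-Xpow n 0₄) ⟩
    (0₄ ∷ pad n []) + - hc                      ≡⟨ cong (λ v → (0₄ ∷ v) + - hc) pad-[] ⟩
    0R + - hc                                   ≡⟨ +-identityˡ (- hc) ⟩
    - hc                                        ∎
    where
    open ≡-Reasoning
    ξ^n≡pad : ξ ^R n ≡ pad m (P4.Xpow n)
    ξ^n≡pad = trans (sym (eval-Xpow n)) (eval-pad (P4.Xpow n) (ℕP.≤-reflexive (length-Xpow n)))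

  eval-h : eval (hPoly hc) ≡ 0R
  eval-h = begin
    eval (Vec.toList hc ++ [ 1₄ ])                                         ≡⟨ eval-++ (Vec.toList hc) [ 1₄ ] ⟩
    eval (Vec.toList hc) + ξ ^R List.length (Vec.toList hc) * eval [ 1₄ ] ≡⟨ cong₂ (λ x k → x + ξ ^R k * eval [ 1₄ ])
                                                                                (*R-identityʳ hc) (VecP.length-toList hc) ⟩
    hc + ξ ^R m * eval [ 1₄ ]                                              ≡⟨ cong₂ (λ x y → hc + x * y) ξ^m≡-hc (eval-Xpow 0) ⟩
    hc + - hc * 1R                                                         ≡⟨ cong (hc +_) (*-identityʳ (- hc)) ⟩
    hc + - hc                                                              ≡⟨ -‿inverseʳ hc ⟩
    0R                                                                     ∎
    where open ≡-Reasoning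

  h∣⇒eval≡0 : ∀ {p} → hPoly hc P4.∣ p → eval p ≡ 0R
  h∣⇒eval≡0 {p} (q , q*h≈p) = begin
    eval p                     ≡⟨ sym (eval-≈ (q P4.⊗ hPoly hc) p q*h≈p) ⟩
    eval (q P4.⊗ hPoly hc)     ≡⟨ eval-⊗ q (hPoly hc) ⟩
    eval q * eval (hPoly hc)   ≡⟨ cong (eval q *_) eval-h ⟩
    eval q * 0R                ≡⟨ zeroʳ (eval q) ⟩
    0R                         ∎
    where open ≡-Reasoning

  ξ^k≡1 : ∀ k → hPoly hc P4.∣ P4.Xpow-1 k → ξ ^R k ≡ 1R
  ξ^k≡1 k h∣X^k-1 = begin
    ξ ^R k                                     ≡⟨ solve 1 (λ X → X := (X :+ con (-₄ 1₄)) :+ con 1₄) refl (ξ ^R k) ⟩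
    (ξ ^R k + ⟦ -₄ 1₄ ⟧) + ⟦ 1₄ ⟧             ≡⟨ sym (cong₂ (λ x y → (x + y) + ⟦ 1₄ ⟧) (eval-Xpow k) (eval-const (-₄ 1₄))) ⟩
    (eval (P4.Xpow k) + eval [ -₄ 1₄ ]) + ⟦ 1₄ ⟧ ≡⟨ cong (_+ ⟦ 1₄ ⟧) (sym (eval-⊕ (P4.Xpow k) [ -₄ 1₄ ])) ⟩
    eval (P4.Xpow-1 k) + ⟦ 1₄ ⟧                ≡⟨ cong₂ _+_ (h∣⇒eval≡0 {P4.Xpow-1 k} h∣X^k-1) ⟦⟧-1 ⟩
    0R + 1R                                    ≡⟨ +-identityˡ 1R ⟩
    1R                                         ∎
    where open ≡-Reasoning

  ^R-+ : ∀ x a b → x ^R (a ℕ.+ b) ≡ x ^R a * x ^R b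
  ^R-+ x zero    b = sym (*-identityˡ _)
  ^R-+ x (suc a) b = trans (cong (x *_) (^R-+ x a b)) (sym (*R-assoc x (x ^R a) (x ^R b)))

  ^R-* : ∀ x a b → x ^R (a ℕ.* b) ≡ (x ^R b) ^R a
  ^R-* x zero    b = refl
  ^R-* x (suc a) b = trans (^R-+ x b (a ℕ.* b)) (cong (x ^R b *_) (^R-* x a b))

  1^R : ∀ k → 1R ^R k ≡ 1R
  1^R zero    = refl
  1^R (suc k) = trans (*-identityˡ _) (1^R k)

  *-^R : ∀ u v k → (u * v) ^R k ≡ u ^R k * v ^R k
  *-^R u v zero    = sym (*-identityˡ 1R)
  *-^R u v (suc k) = trans (cong (u * v *_) (*-^R u v k))
    (solve 4 (λ U V A B → (U :* V) :* (A :* B) := (U :* A) :* (V :* B)) refl u v (u ^R k) (v ^R k))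

  ^R-1 : ∀ x → x ^R 1 ≡ x
  ^R-1 = *-identityʳ

  ^R-2^[1+k] : ∀ x k → x ^R (2 ^ suc k) ≡ x ^R (2 ^ k) * x ^R (2 ^ k)
  ^R-2^[1+k] x k = trans (^R-* x 2 (2 ^ k)) (cong (x ^R (2 ^ k) *_) (*-identityʳ _))

  -- Congruence modulo 2

  -- 2R is the kernel of multiplication by 2, so x - y ∈ 2R iff 2x = 2y.
  infix 4 _≈₂_
  record _≈₂_ (x y : R) : Set where
    constructor mk≈₂
    field twice-≡ : 2₄ ·ᵥ x ≡ 2₄ ·ᵥ y
  open _≈₂_ public

  ≈₂-isEquivalence : IsEquivalence _≈₂_
  ≈₂-isEquivalence = record
    { refl  = mk≈₂ refl
    ; sym   = λ (mk≈₂ e) → mk≈₂ (sym e)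
    ; trans = λ (mk≈₂ e) (mk≈₂ f) → mk≈₂ (trans e f) }

  ≈₂-setoid : Setoid 0ℓ 0ℓ
  ≈₂-setoid = record { isEquivalence = ≈₂-isEquivalence }

  open IsEquivalence ≈₂-isEquivalence public
    using () renaming (refl to ≈₂-refl; sym to ≈₂-sym; trans to ≈₂-trans)

  ≡⇒≈₂ : ∀ {x y} → x ≡ y → x ≈₂ y
  ≡⇒≈₂ e = mk≈₂ (cong (2₄ ·ᵥ_) e)

  infix 4 _≈₂?_
  _≈₂?_ : ∀ x y → Dec (x ≈₂ y)
  x ≈₂? y = map′ mk≈₂ twice-≡ ((2₄ ·ᵥ x) ≟R (2₄ ·ᵥ y))

  +-resp-≈₂ : ∀ {x y u v} → x ≈₂ y → u ≈₂ v → x + u ≈₂ y + v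
  +-resp-≈₂ {x} {y} {u} {v} (mk≈₂ e) (mk≈₂ f) = mk≈₂ (begin
    2₄ ·ᵥ (x + u)         ≡⟨ ·ᵥ-distribˡ 2₄ x u ⟩
    2₄ ·ᵥ x + 2₄ ·ᵥ u     ≡⟨ cong₂ _+_ e f ⟩
    2₄ ·ᵥ y + 2₄ ·ᵥ v     ≡⟨ sym (·ᵥ-distribˡ 2₄ y v) ⟩
    2₄ ·ᵥ (y + v)         ∎)
    where open ≡-Reasoning

  *-resp-≈₂ : ∀ {x y u v} → x ≈₂ y → u ≈₂ v → x * u ≈₂ y * v
  *-resp-≈₂ {x} {y} {u} {v} (mk≈₂ e) (mk≈₂ f) = mk≈₂ (begin
    2₄ ·ᵥ (x * u)     ≡⟨ sym (·-*ˡ 2₄ x u) ⟩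
    (2₄ ·ᵥ x) * u     ≡⟨ cong (_* u) e ⟩
    (2₄ ·ᵥ y) * u     ≡⟨ ·-*ˡ 2₄ y u ⟩
    2₄ ·ᵥ (y * u)     ≡⟨ sym (·-*ʳ 2₄ y u) ⟩
    y * (2₄ ·ᵥ u)     ≡⟨ cong (y *_) f ⟩
    y * (2₄ ·ᵥ v)     ≡⟨ ·-*ʳ 2₄ y v ⟩
    2₄ ·ᵥ (y * v)     ∎)
    where open ≡-Reasoning

  +-congˡ-≈₂ : ∀ x {y z} → y ≈₂ z → x + y ≈₂ x + z
  +-congˡ-≈₂ x = +-resp-≈₂ (≈₂-refl {x})

  +-congʳ-≈₂ : ∀ x {y z} → y ≈₂ z → y + x ≈₂ z + x
  +-congʳ-≈₂ x y≈z = +-resp-≈₂ y≈z (≈₂-refl {x})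

  *-congˡ-≈₂ : ∀ x {y z} → y ≈₂ z → x * y ≈₂ x * z
  *-congˡ-≈₂ x = *-resp-≈₂ (≈₂-refl {x})

  *-congʳ-≈₂ : ∀ x {y z} → y ≈₂ z → y * x ≈₂ z * x
  *-congʳ-≈₂ x y≈z = *-resp-≈₂ y≈z (≈₂-refl {x})

  ·-resp-≈₂ : ∀ c {x y} → x ≈₂ y → c ·ᵥ x ≈₂ c ·ᵥ y
  ·-resp-≈₂ c {x} {y} x≈y = begin
    c ·ᵥ x     ≡⟨ ·≡⟦⟧* c x ⟩
    ⟦ c ⟧ * x  ≈⟨ *-congˡ-≈₂ ⟦ c ⟧ x≈y ⟩
    ⟦ c ⟧ * y  ≡⟨ sym (·≡⟦⟧* c y) ⟩
    c ·ᵥ y     ∎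
    where open ≈-Reasoning ≈₂-setoid

  -‿resp-≈₂ : ∀ {x y} → x ≈₂ y → - x ≈₂ - y
  -‿resp-≈₂ = ·-resp-≈₂ (-₄ 1₄)

  ^R-resp-≈₂ : ∀ {x y} → x ≈₂ y → ∀ k → x ^R k ≈₂ y ^R k
  ^R-resp-≈₂ x≈y zero    = ≈₂-refl
  ^R-resp-≈₂ x≈y (suc k) = *-resp-≈₂ x≈y (^R-resp-≈₂ x≈y k)

  2*≈₂0 : ∀ w → ⟦ 2₄ ⟧ * w ≈₂ 0R
  2*≈₂0 w = mk≈₂ (begin
    2₄ ·ᵥ (⟦ 2₄ ⟧ * w)   ≡⟨ cong (2₄ ·ᵥ_) (sym (·≡⟦⟧* 2₄ w)) ⟩
    2₄ ·ᵥ (2₄ ·ᵥ w)      ≡⟨ sym (·ᵥ-assoc 2₄ 2₄ w) ⟩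
    0₄ ·ᵥ w              ≡⟨ ·ᵥ-zeroˡ w ⟩
    0R                   ≡⟨ sym (·ᵥ-zeroʳ 2₄) ⟩
    2₄ ·ᵥ 0R             ∎)
    where open ≡-Reasoning

  affine-interpolation : ∀ {x y x′ y′ z a b} → (x - y) * z ≈₂ 1R → a ≈₂ (x′ - y′) * z → b ≈₂ x′ - a * x
    → a * x + b ≈₂ x′ × a * y + b ≈₂ y′
  affine-interpolation {x} {y} {x′} {y′} {z} {a} {b} [x-y]z≈1 a≈ b≈ = ax+b≈x′ , ay+b≈y′
    where
    open ≈-Reasoning ≈₂-setoid
    ax+b≈x′ : a * x + b ≈₂ x′
    ax+b≈x′ = begin
      a * x + b              ≈⟨ +-congˡ-≈₂ (a * x) b≈ ⟩
      a * x + (x′ - a * x)   ≡⟨ solve 3 (λ A X X′ → A :* X :+ (X′ :- A :* X) := X′) refl a x x′ ⟩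
      x′                     ∎
    ay+b≈y′ : a * y + b ≈₂ y′
    ay+b≈y′ = begin
      a * y + b                        ≈⟨ +-congˡ-≈₂ (a * y) b≈ ⟩
      a * y + (x′ - a * x)             ≡⟨ solve 4 (λ A Y X X′ → A :* Y :+ (X′ :- A :* X) := X′ :- A :* (X :- Y)) refl a y x x′ ⟩
      x′ - a * (x - y)                 ≈⟨ +-congˡ-≈₂ x′ (-‿resp-≈₂ (*-congʳ-≈₂ (x - y) a≈)) ⟩
      x′ - ((x′ - y′) * z) * (x - y)   ≡⟨ solve 4 (λ X′ Y′ Z D → X′ :- ((X′ :- Y′) :* Z) :* D := X′ :- (X′ :- Y′) :* (D :* Z))
                                                 refl x′ y′ z (x - y) ⟩
      x′ - (x′ - y′) * ((x - y) * z)   ≈⟨ +-congˡ-≈₂ x′ (-‿resp-≈₂ (*-congˡ-≈₂ (x′ - y′) [x-y]z≈1)) ⟩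
      x′ - (x′ - y′) * 1R              ≡⟨ cong (λ w → x′ - w) (*-identityʳ (x′ - y′)) ⟩
      x′ - (x′ - y′)                   ≡⟨ solve 2 (λ X′ Y′ → X′ :- (X′ :- Y′) := Y′) refl x′ y′ ⟩
      y′                               ∎

  ≈₂⇒square≡ : ∀ {x y} → x ≈₂ y → x * x ≡ y * y
  ≈₂⇒square≡ {x} {y} (mk≈₂ e) with 2·≡⇒≡+2· x y e
  ... | w , x≡y+2w = begin
    x * x                                  ≡⟨ cong₂ _*_ x≡y+2w x≡y+2w ⟩
    (y + 2₄ ·ᵥ w) * (y + 2₄ ·ᵥ w)          ≡⟨ cong (λ z → (y + z) * (y + z)) (·≡⟦⟧* 2₄ w) ⟩
    (y + ⟦ 2₄ ⟧ * w) * (y + ⟦ 2₄ ⟧ * w)    ≡⟨ solve 2 (λ Y W → (Y :+ con 2₄ :* W) :* (Y :+ con 2₄ :* W) := Y :* Y) refl y w ⟩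
    y * y                                  ∎
    where open ≡-Reasoning

  ≈₂⇒^2^[1+k]≡ : ∀ {x y} → x ≈₂ y → ∀ k → x ^R (2 ^ suc k) ≡ y ^R (2 ^ suc k)
  ≈₂⇒^2^[1+k]≡ {x} {y} x≈y zero = begin
    x ^R 2   ≡⟨ cong (x *_) (*-identityʳ x) ⟩
    x * x    ≡⟨ ≈₂⇒square≡ x≈y ⟩
    y * y    ≡⟨ sym (cong (y *_) (*-identityʳ y)) ⟩
    y ^R 2   ∎
    where open ≡-Reasoning
  ≈₂⇒^2^[1+k]≡ {x} {y} x≈y (suc k) = begin
    x ^R (2 ^ suc (suc k))                          ≡⟨ ^R-2^[1+k] x (suc k) ⟩
    x ^R (2 ^ suc k) * x ^R (2 ^ suc k)             ≡⟨ cong₂ _*_ (≈₂⇒^2^[1+k]≡ x≈y k) (≈₂⇒^2^[1+k]≡ x≈y k) ⟩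
    y ^R (2 ^ suc k) * y ^R (2 ^ suc k)             ≡⟨ sym (^R-2^[1+k] y (suc k)) ⟩
    y ^R (2 ^ suc (suc k))                          ∎
    where open ≡-Reasoning

  coeff-X*v : ∀ v i → P4.coeff (0₄ ∷ Vec.toList v) i
    ≡ (proj₂ (shiftIn v 0₄) *₄ P4.coeff (hPoly hc) i) +₄ P4.coeff (Vec.toList (ξ * v)) i
  coeff-X*v v i = begin
    P4.coeff (0₄ ∷ Vec.toList v) i
      ≡⟨ cong (λ p → P4.coeff p i) (sym (shiftIn-toList v 0₄)) ⟩
    P4.coeff (Vec.toList s ++ [ l ]) i
      ≡⟨ coeff-snoc s hc l i ⟩
    (l *₄ P4.coeff (hPoly hc) i) +₄ P4.coeff (Vec.toList (s +ᵥ (-₄ l) ·ᵥ hc)) i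
      ≡⟨ cong (λ z → (l *₄ P4.coeff (hPoly hc) i) +₄ P4.coeff (Vec.toList z) i)
              (sym (trans (ξ-*≡ξ* v) (ξ*≡reduce∘shiftIn v))) ⟩
    (l *₄ P4.coeff (hPoly hc) i) +₄ P4.coeff (Vec.toList (ξ * v)) i ∎
    where
    open ≡-Reasoning
    s = proj₁ (shiftIn v 0₄)
    l = proj₂ (shiftIn v 0₄)

  Xpow-quotient : ℕ → P4.Pol
  Xpow-quotient zero    = []
  Xpow-quotient (suc k) = proj₂ (shiftIn (ξ ^R k) 0₄) ∷ Xpow-quotient k

  Xpow-division : ∀ k i → P4.coeff (P4.Xpow k) i
    ≡ P4.coeff (Xpow-quotient k P4.⊗ hPoly hc) i +₄ P4.coeff (Vec.toList (ξ ^R k)) i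
  Xpow-division zero    zero    = refl
  Xpow-division zero    (suc i) = sym (trans (+₄-identityˡ _) (coeff-0ᵥ {n} i))
  Xpow-division (suc k) i = begin
    P4.coeff (0₄ ∷ P4.Xpow k) i                    ≡⟨ shifted i ⟩
    c₀ +₄ P4.coeff (0₄ ∷ Vec.toList (ξ ^R k)) i    ≡⟨ cong (c₀ +₄_) (coeff-X*v (ξ ^R k) i) ⟩
    c₀ +₄ (lh +₄ c₁)                               ≡⟨ sym (+₄-assoc c₀ lh c₁) ⟩
    (c₀ +₄ lh) +₄ c₁                               ≡⟨ cong (_+₄ c₁) (+₄-comm c₀ lh) ⟩
    (lh +₄ c₀) +₄ c₁                               ≡⟨ cong (λ z → (z +₄ c₀) +₄ c₁) (sym (P4-coeff.coeff-scale l h i)) ⟩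
    (P4.coeff (P4.scale l h) i +₄ c₀) +₄ c₁        ≡⟨ cong (_+₄ c₁) (sym (P4-coeff.coeff-⊕ (P4.scale l h) (0₄ ∷ (Xpow-quotient k P4.⊗ h)) i)) ⟩
    P4.coeff (Xpow-quotient (suc k) P4.⊗ h) i +₄ c₁ ∎
    where
    open ≡-Reasoning
    h  = hPoly hc
    l  = proj₂ (shiftIn (ξ ^R k) 0₄)
    lh = l *₄ P4.coeff h i
    c₀ = P4.coeff (0₄ ∷ (Xpow-quotient k P4.⊗ h)) i
    c₁ = P4.coeff (Vec.toList (ξ ^R suc k)) i
    shifted : ∀ j → P4.coeff (0₄ ∷ P4.Xpow k) j
      ≡ P4.coeff (0₄ ∷ (Xpow-quotient k P4.⊗ h)) j +₄ P4.coeff (0₄ ∷ Vec.toList (ξ ^R k)) j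
    shifted zero    = refl
    shifted (suc j) = Xpow-division k j

  ξ^k≈₂1⇒h₂∣X^k-1 : ∀ k → ξ ^R k ≈₂ 1R → h2Poly hc P2.∣ P2.Xpow-1 k
  ξ^k≈₂1⇒h₂∣X^k-1 k (mk≈₂ ξ^k≈1) = q₂ , λ i → begin
    P2.coeff (q₂ P2.⊗ h2Poly hc) i                  ≡⟨ +₂-flip _ _ _ (reduced-division i) ⟩
    P2.coeff (P2.Xpow k) i +₂ P2.coeff [ 1₂ ] i     ≡⟨ sym (P2-coeff.coeff-⊕ (P2.Xpow k) [ 1₂ ] i) ⟩
    P2.coeff (P2.Xpow-1 k) i                        ∎
    where
    open ≡-Reasoning
    q₂ = List.map red (Xpow-quotient k)
    red-coeff-1R : ∀ i → red (P4.coeff (Vec.toList 1R) i) ≡ P2.coeff [ 1₂ ] i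
    red-coeff-1R zero    = refl
    red-coeff-1R (suc i) = cong red (coeff-0ᵥ {n} i)
    reduced-division : ∀ i → P2.coeff (P2.Xpow k) i ≡ P2.coeff (q₂ P2.⊗ h2Poly hc) i +₂ P2.coeff [ 1₂ ] i
    reduced-division i = begin
      P2.coeff (P2.Xpow k) i                    ≡⟨ cong (λ p → P2.coeff p i) (sym (red-Xpow k)) ⟩
      P2.coeff (List.map red (P4.Xpow k)) i     ≡⟨ red-coeff (P4.Xpow k) i ⟩
      red (P4.coeff (P4.Xpow k) i)              ≡⟨ cong red (Xpow-division k i) ⟩
      red (qh +₄ r)                             ≡⟨ red-+ qh r ⟩
      red qh +₂ red r                           ≡⟨ cong₂ _+₂_ (sym (red-coeff (Xpow-quotient k P4.⊗ hPoly hc) i))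
                                                              (2·≡⇒red-coeff≡ (ξ ^R k) 1R ξ^k≈1 i) ⟩
      P2.coeff (List.map red (Xpow-quotient k P4.⊗ hPoly hc)) i +₂ red (P4.coeff (Vec.toList 1R) i)
                                                ≡⟨ cong₂ _+₂_ (cong (λ p → P2.coeff p i) (red-⊗ (Xpow-quotient k) (hPoly hc)))
                                                              (red-coeff-1R i) ⟩
      P2.coeff (q₂ P2.⊗ h2Poly hc) i +₂ P2.coeff [ 1₂ ] i ∎
      where
      qh = P4.coeff (Xpow-quotient k P4.⊗ hPoly hc) i
      r  = P4.coeff (Vec.toList (ξ ^R k)) i

  allVec-complete : ∀ k (v : Vec Z4 k) → v ∈ allVec k
  allVec-complete zero    []      = here refl
  allVec-complete (suc k) (a ∷ v) = ∈-cartesianProductWith⁺ _∷_ (∈-allFin a) (allVec-complete k v)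

  allVec-unique : ∀ k → Unique (allVec k)
  allVec-unique zero    = [] ∷ []
  allVec-unique (suc k) = cartesianProductWith⁺ _∷_ VecP.∷-injective (allFin⁺ 4) (allVec-unique k)

  module Sumᴿ = ListSum (CommutativeRing.+-isCommutativeMonoid ring)

  sumᴿ : List R → (R → R) → R
  sumᴿ = Sumᴿ.sumOver

  sumᴿ-resp-≈₂ : ∀ {xs F G} → (∀ {x} → x ∈ xs → F x ≈₂ G x) → sumᴿ xs F ≈₂ sumᴿ xs G
  sumᴿ-resp-≈₂ {[]}     F≈G = ≈₂-refl
  sumᴿ-resp-≈₂ {x ∷ xs} F≈G = +-resp-≈₂ (F≈G (here refl)) (sumᴿ-resp-≈₂ (F≈G ∘ there))

  sumᴿ-affine : ∀ xs (c : R → Z4) (α : R) (F H : R → R) → sumᴿ xs (λ x → c x ·ᵥ (α * F x + H x))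
    ≡ α * sumᴿ xs (λ x → c x ·ᵥ F x) + sumᴿ xs (λ x → c x ·ᵥ H x)
  sumᴿ-affine []       c α F H = sym (trans (cong (_+ 0R) (zeroʳ α)) (+-identityˡ 0R))
  sumᴿ-affine (y ∷ xs) c α F H = begin
    c y ·ᵥ (α * F y + H y) + sumᴿ xs (λ x → c x ·ᵥ (α * F x + H x))
      ≡⟨ cong₂ _+_ (·≡⟦⟧* (c y) _) (sumᴿ-affine xs c α F H) ⟩
    ⟦ c y ⟧ * (α * F y + H y) + (α * SF + SH)
      ≡⟨ solve 6 (λ C A Fy Hy SF SH → C :* (A :* Fy :+ Hy) :+ (A :* SF :+ SH) := A :* (C :* Fy :+ SF) :+ (C :* Hy :+ SH))
               refl ⟦ c y ⟧ α (F y) (H y) SF SH ⟩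
    α * (⟦ c y ⟧ * F y + SF) + (⟦ c y ⟧ * H y + SH)
      ≡⟨ sym (cong₂ (λ u v → α * (u + SF) + (v + SH)) (·≡⟦⟧* (c y) (F y)) (·≡⟦⟧* (c y) (H y))) ⟩
    α * (c y ·ᵥ F y + SF) + (c y ·ᵥ H y + SH) ∎
    where
    open ≡-Reasoning
    SF = sumᴿ xs (λ x → c x ·ᵥ F x)
    SH = sumᴿ xs (λ x → c x ·ᵥ H x)

  sumᴿ-const : ∀ xs (c : R → Z4) (β : R) → sumᴿ xs (λ x → c x ·ᵥ β) ≡ Sum₄.sumOver xs c ·ᵥ β
  sumᴿ-const []       c β = sym (·ᵥ-zeroˡ β)
  sumᴿ-const (y ∷ xs) c β = trans (cong (c y ·ᵥ β +_) (sumᴿ-const xs c β)) (sym (·ᵥ-distribʳ (c y) _ β))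

  sumᴿ-affine-≡0 : ∀ xs (c : R → Z4) (α : R) (F H : R → R)
    → α * sumᴿ xs (λ x → c x ·ᵥ F x) ≡ 0R → sumᴿ xs (λ x → c x ·ᵥ H x) ≡ 0R
    → sumᴿ xs (λ x → c x ·ᵥ (α * F x + H x)) ≡ 0R
  sumᴿ-affine-≡0 xs c α F H αSF≡0 SH≡0 =
    trans (sumᴿ-affine xs c α F H) (trans (cong₂ _+_ αSF≡0 SH≡0) (+-identityˡ 0R))

  sumᴿ-affine-≈₂0 : ∀ xs (c : R → Z4) (α : R) (F H : R → R)
    → sumᴿ xs (λ x → c x ·ᵥ F x) ≈₂ 0R → sumᴿ xs (λ x → c x ·ᵥ H x) ≈₂ 0R
    → sumᴿ xs (λ x → c x ·ᵥ (α * F x + H x)) ≈₂ 0R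
  sumᴿ-affine-≈₂0 xs c α F H SF≈0 SH≈0 = begin
    sumᴿ xs (λ x → c x ·ᵥ (α * F x + H x))                        ≡⟨ sumᴿ-affine xs c α F H ⟩
    α * sumᴿ xs (λ x → c x ·ᵥ F x) + sumᴿ xs (λ x → c x ·ᵥ H x)   ≈⟨ +-resp-≈₂ (*-congˡ-≈₂ α SF≈0) SH≈0 ⟩
    α * 0R + 0R                                                   ≡⟨ trans (+-identityʳ _) (zeroʳ α) ⟩
    0R                                                            ∎
    where open ≈-Reasoning ≈₂-setoid

  +2*≈₂ : ∀ x w → x + ⟦ 2₄ ⟧ * w ≈₂ x
  +2*≈₂ x w = ≈₂-trans (+-congˡ-≈₂ x (2*≈₂0 w)) (≡⇒≈₂ (+-identityʳ x))

  ≈₂0⇒2*≡0 : ∀ {x} → x ≈₂ 0R → ⟦ 2₄ ⟧ * x ≡ 0R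
  ≈₂0⇒2*≡0 {x} (mk≈₂ 2x≡2·0) = trans (sym (·≡⟦⟧* 2₄ x)) (trans 2x≡2·0 (·ᵥ-zeroʳ 2₄))

  ≈₂0⇒2·≡0 : ∀ {x} → x ≈₂ 0R → 2₄ ·ᵥ x ≡ 0R
  ≈₂0⇒2·≡0 (mk≈₂ 2x≡2·0) = trans 2x≡2·0 (·ᵥ-zeroʳ 2₄)

  2·≡0⇒≈₂0 : ∀ {x} → 2₄ ·ᵥ x ≡ 0R → x ≈₂ 0R
  2·≡0⇒≈₂0 2x≡0 = mk≈₂ (trans 2x≡0 (sym (·ᵥ-zeroʳ 2₄)))

  0^R-2^k : ∀ k → 0R ^R (2 ^ k) ≡ 0R
  0^R-2^k k = trans (cong (0R ^R_) (sym (ℕP.suc-pred (2 ^ k) ⦃ ℕP.m^n≢0 2 k ⦄))) (zeroˡ _)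

  ·-square≈₂ : ∀ k y → (k ·ᵥ y) * (k ·ᵥ y) ≈₂ k ·ᵥ (y * y)
  ·-square≈₂ k y = mk≈₂ (begin
    2₄ ·ᵥ ((k ·ᵥ y) * (k ·ᵥ y))   ≡⟨ cong (2₄ ·ᵥ_) (trans (·-*ˡ k y (k ·ᵥ y)) (cong (k ·ᵥ_) (·-*ʳ k y y))) ⟩
    2₄ ·ᵥ (k ·ᵥ (k ·ᵥ (y * y)))   ≡⟨ cong (2₄ ·ᵥ_) (sym (·ᵥ-assoc k k (y * y))) ⟩
    2₄ ·ᵥ ((k *₄ k) ·ᵥ (y * y))   ≡⟨ sym (·ᵥ-assoc 2₄ (k *₄ k) (y * y)) ⟩
    (2₄ *₄ (k *₄ k)) ·ᵥ (y * y)   ≡⟨ cong (_·ᵥ (y * y)) (2*[a*a]≡2*a k) ⟩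
    (2₄ *₄ k) ·ᵥ (y * y)          ≡⟨ ·ᵥ-assoc 2₄ k (y * y) ⟩
    2₄ ·ᵥ (k ·ᵥ (y * y))          ∎)
    where open ≡-Reasoning

  sumᴿ-square≈₂ : ∀ xs (c : R → Z4) (F : R → R) →
    sumᴿ xs (λ x → c x ·ᵥ F x) * sumᴿ xs (λ x → c x ·ᵥ F x) ≈₂ sumᴿ xs (λ x → c x ·ᵥ (F x * F x))
  sumᴿ-square≈₂ []       c F = ≡⇒≈₂ (zeroˡ 0R)
  sumᴿ-square≈₂ (y ∷ xs) c F = begin
    (u + s) * (u + s)                    ≡⟨ solve 2 (λ U S → (U :+ S) :* (U :+ S) := (U :* U :+ S :* S) :+ con 2₄ :* (U :* S))
                                                    refl u s ⟩
    (u * u + s * s) + ⟦ 2₄ ⟧ * (u * s)   ≈⟨ +2*≈₂ (u * u + s * s) (u * s) ⟩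
    u * u + s * s                        ≈⟨ +-resp-≈₂ (·-square≈₂ (c y) (F y)) (sumᴿ-square≈₂ xs c F) ⟩
    c y ·ᵥ (F y * F y) + sumᴿ xs (λ x → c x ·ᵥ (F x * F x)) ∎
    where
    open ≈-Reasoning ≈₂-setoid
    u = c y ·ᵥ F y
    s = sumᴿ xs (λ x → c x ·ᵥ F x)

  sumᴿ-frobenius : ∀ xs (c : R → Z4) k → sumᴿ xs (λ x → c x ·ᵥ x ^R (2 ^ k)) ≈₂ (sumᴿ xs (λ x → c x ·ᵥ x)) ^R (2 ^ k)
  sumᴿ-frobenius xs c zero    = ≡⇒≈₂ (trans (Sumᴿ.sumOver-cong {xs = xs} (λ {x} _ → cong (c x ·ᵥ_) (^R-1 x))) (sym (^R-1 _)))
  sumᴿ-frobenius xs c (suc k) = begin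
    sumᴿ xs (λ x → c x ·ᵥ x ^R (2 ^ suc k))                 ≡⟨ Sumᴿ.sumOver-cong {xs = xs} (λ {x} _ → cong (c x ·ᵥ_) (^R-2^[1+k] x k)) ⟩
    sumᴿ xs (λ x → c x ·ᵥ (x ^R (2 ^ k) * x ^R (2 ^ k)))    ≈⟨ ≈₂-sym (sumᴿ-square≈₂ xs c (λ x → x ^R (2 ^ k))) ⟩
    S₂ᵏ * S₂ᵏ                                               ≡⟨ ≈₂⇒square≡ (sumᴿ-frobenius xs c k) ⟩
    S ^R (2 ^ k) * S ^R (2 ^ k)                             ≡⟨ sym (^R-2^[1+k] S k) ⟩
    S ^R (2 ^ suc k)                                        ∎
    where
    open ≈-Reasoning ≈₂-setoid
    S   = sumᴿ xs (λ x → c x ·ᵥ x)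
    S₂ᵏ = sumᴿ xs (λ x → c x ·ᵥ x ^R (2 ^ k))

  binomial-2^[1+k] : ∀ u v k → (u + v) ^R (2 ^ suc k) ≡ u ^R (2 ^ suc k) + v ^R (2 ^ suc k) + ⟦ 2₄ ⟧ * (u * v) ^R (2 ^ k)
  binomial-2^[1+k] u v zero = begin
    (u + v) ^R 2                   ≡⟨ cong ((u + v) *_) (^R-1 (u + v)) ⟩
    (u + v) * (u + v)              ≡⟨ solve 2 (λ U V → (U :+ V) :* (U :+ V) := U :* U :+ V :* V :+ con 2₄ :* (U :* V)) refl u v ⟩
    u * u + v * v + ⟦ 2₄ ⟧ * (u * v)          ≡⟨ cong (λ r → u * u + v * v + ⟦ 2₄ ⟧ * r) (sym (^R-1 (u * v))) ⟩
    u * u + v * v + ⟦ 2₄ ⟧ * (u * v) ^R 1     ≡⟨ sym (cong₂ (λ p q → u * p + v * q + ⟦ 2₄ ⟧ * (u * v) ^R 1) (^R-1 u) (^R-1 v)) ⟩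
    u ^R 2 + v ^R 2 + ⟦ 2₄ ⟧ * (u * v) ^R 1   ∎
    where open ≡-Reasoning
  binomial-2^[1+k] u v (suc k) = begin
    (u + v) ^R (2 ^ suc (suc k))            ≡⟨ ^R-2^[1+k] (u + v) (suc k) ⟩
    (u + v) ^R (2 ^ suc k) * (u + v) ^R (2 ^ suc k)
                                            ≡⟨ cong₂ _*_ (binomial-2^[1+k] u v k) (binomial-2^[1+k] u v k) ⟩
    (U + V + ⟦ 2₄ ⟧ * W) * (U + V + ⟦ 2₄ ⟧ * W)
                                            ≡⟨ solve 3 (λ U V W → (U :+ V :+ con 2₄ :* W) :* (U :+ V :+ con 2₄ :* W)
                                                                 := U :* U :+ V :* V :+ con 2₄ :* (U :* V))
                                                     refl U V W ⟩
    U * U + V * V + ⟦ 2₄ ⟧ * (U * V)        ≡⟨ cong (λ r → U * U + V * V + ⟦ 2₄ ⟧ * r) (sym (*-^R u v (2 ^ suc k))) ⟩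
    U * U + V * V + ⟦ 2₄ ⟧ * (u * v) ^R (2 ^ suc k)
                                            ≡⟨ sym (cong₂ (λ p q → p + q + ⟦ 2₄ ⟧ * (u * v) ^R (2 ^ suc k))
                                                          (^R-2^[1+k] u (suc k)) (^R-2^[1+k] v (suc k))) ⟩
    u ^R (2 ^ suc (suc k)) + v ^R (2 ^ suc (suc k)) + ⟦ 2₄ ⟧ * (u * v) ^R (2 ^ suc k) ∎
    where
    open ≡-Reasoning
    U = u ^R (2 ^ suc k)
    V = v ^R (2 ^ suc k)
    W = (u * v) ^R (2 ^ k)

  binomial-≈₂ : ∀ u v j → (u + v) ^R (2 ^ j) ≈₂ u ^R (2 ^ j) + v ^R (2 ^ j)
  binomial-≈₂ u v zero    = ≡⇒≈₂ (trans (^R-1 (u + v)) (sym (cong₂ _+_ (^R-1 u) (^R-1 v))))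
  binomial-≈₂ u v (suc k) = ≈₂-trans (≡⇒≈₂ (binomial-2^[1+k] u v k)) (+2*≈₂ _ _)

-- The Teichmüller set, for h primitive modulo 2

module PrimitiveGaloisRing (n : ℕ) (hc : Vec Z4 (suc n))
  (h₂-primitive : PrimitiveZ2 (suc n) (h2Poly hc)) (h∣X^N-1 : hPoly hc P4.∣ P4.Xpow-1 (2 ^ suc n ∸ 1)) where

  open GaloisRing n hc public

  N : ℕ
  N = 2 ^ suc n ∸ 1

  1+N≡2^m : suc N ≡ 2 ^ suc n
  1+N≡2^m = trans (ℕP.+-comm 1 N) (ℕP.m∸n+n≡m (ℕP.m^n>0 2 (suc n)))

  ξ^N≡1 : ξ ^R N ≡ 1R
  ξ^N≡1 = ξ^k≡1 N h∣X^N-1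

  ξ^i*ξ^[N-i]≡1 : ∀ i → i ≤ N → ξ ^R i * ξ ^R (N ∸ i) ≡ 1R
  ξ^i*ξ^[N-i]≡1 i i≤N = trans (sym (^R-+ ξ i (N ∸ i))) (trans (cong (ξ ^R_) (ℕP.m+[n∸m]≡n i≤N)) ξ^N≡1)

  1≉₂0 : ¬ (1R ≈₂ 0R)
  1≉₂0 (mk≈₂ e) with VecP.∷-injectiveˡ e
  ... | ()

  unit≉₂0 : ∀ {x z} → x * z ≈₂ 1R → ¬ (x ≈₂ 0R)
  unit≉₂0 {x} {z} xz≈1 x≈0 = 1≉₂0 (begin
    1R      ≈⟨ ≈₂-sym xz≈1 ⟩
    x * z   ≈⟨ *-resp-≈₂ x≈0 (≈₂-refl {z}) ⟩
    0R * z  ≡⟨ zeroˡ z ⟩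
    0R      ∎)
    where open ≈-Reasoning ≈₂-setoid

  ξ^k≉₂0 : ∀ k → ¬ (ξ ^R k ≈₂ 0R)
  ξ^k≉₂0 k = unit≉₂0 {z = (ξ ^R (N ∸ 1)) ^R k} (≡⇒≈₂ (begin
    ξ ^R k * (ξ ^R (N ∸ 1)) ^R k   ≡⟨ sym (*-^R ξ (ξ ^R (N ∸ 1)) k) ⟩
    (ξ ^R (suc (N ∸ 1))) ^R k      ≡⟨ cong (λ e → (ξ ^R e) ^R k) (ℕP.suc-pred N ⦃ ℕ.>-nonZero N>0 ⦄) ⟩
    (ξ ^R N) ^R k                  ≡⟨ cong (_^R k) ξ^N≡1 ⟩
    1R ^R k                        ≡⟨ 1^R k ⟩
    1R                             ∎))
    where
    open ≡-Reasoning
    N>0 : 0 < N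
    N>0 = ℕP.m<n⇒0<n∸m (ℕP.*-monoʳ-≤ 2 (ℕP.m^n>0 2 n))

  ξ^i≉₂ξ^j : ∀ {i j} → i < j → j < N → ¬ (ξ ^R i ≈₂ ξ ^R j)
  ξ^i≉₂ξ^j {i} {j} i<j j<N ξ^i≈ξ^j =
    has-order-N d (ℕP.m<n⇒0<n∸m i<j) (ℕP.≤-<-trans (ℕP.m∸n≤m j i) j<N) (ξ^k≈₂1⇒h₂∣X^k-1 d ξ^d≈1)
    where
    has-order-N = proj₂ (proj₂ (proj₂ (proj₂ h₂-primitive)))
    d = j ∸ i
    z = ξ ^R (N ∸ i)
    ξ^i*z≡1 = ξ^i*ξ^[N-i]≡1 i (ℕP.<⇒≤ (ℕP.<-trans i<j j<N))
    ξ^d≈1 : ξ ^R d ≈₂ 1R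
    ξ^d≈1 = begin
      ξ ^R d                 ≡⟨ sym (*-identityʳ _) ⟩
      ξ ^R d * 1R            ≡⟨ cong (ξ ^R d *_) (sym ξ^i*z≡1) ⟩
      ξ ^R d * (ξ ^R i * z)  ≡⟨ sym (*R-assoc (ξ ^R d) (ξ ^R i) z) ⟩
      (ξ ^R d * ξ ^R i) * z  ≡⟨ cong (_* z) (sym (^R-+ ξ d i)) ⟩
      ξ ^R (d ℕ.+ i) * z     ≡⟨ cong (λ e → ξ ^R e * z) (ℕP.m∸n+n≡m (ℕP.<⇒≤ i<j)) ⟩
      ξ ^R j * z             ≈⟨ *-resp-≈₂ (≈₂-sym ξ^i≈ξ^j) (≈₂-refl {z}) ⟩
      ξ ^R i * z             ≡⟨ ξ^i*z≡1 ⟩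
      1R                     ∎
      where open ≈-Reasoning ≈₂-setoid

  T-representative : ∀ c → Σ R λ t → InT t × c ≈₂ t
  T-representative c with c ≈₂? 0R
  ... | yes c≈0 = 0R , inj₁ refl , c≈0
  ... | no c≉0 with any? (λ i → c ≈₂? ξ ^R toℕ i)
  ...   | yes (i , c≈ξ^i) = ξ ^R toℕ i , inj₂ (i , refl) , c≈ξ^i
  ...   | no c≉ξ^i = ⊥-elim (no-collision (FinP.pigeonhole (s≤s (ℕP.≤-reflexive (sym 1+N≡2^m))) residue))
    where
    -- c, 0, ξ^0, …, ξ^(N-1) would be N + 2 distinct residues in R/2R, which has only 2^m = N + 1 elements.
    residue : Fin (suc (suc N)) → Fin (2 ^ suc n)
    residue Fin.zero                  = code c
    residue (Fin.suc Fin.zero)        = code 0R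
    residue (Fin.suc (Fin.suc i))     = code (ξ ^R toℕ i)
    residue-injective : ∀ i j → i Fin.< j → residue i ≢ residue j
    residue-injective Fin.zero (Fin.suc Fin.zero) _ e = c≉0 (mk≈₂ (code≡⇒2·≡ c 0R e))
    residue-injective Fin.zero (Fin.suc (Fin.suc j)) _ e = c≉ξ^i (j , mk≈₂ (code≡⇒2·≡ _ _ e))
    residue-injective (Fin.suc Fin.zero) (Fin.suc (Fin.suc j)) _ e =
      ξ^k≉₂0 (toℕ j) (≈₂-sym (mk≈₂ (code≡⇒2·≡ 0R _ e)))
    residue-injective (Fin.suc (Fin.suc i)) (Fin.suc (Fin.suc j)) (s≤s (s≤s i<j)) e =
      ξ^i≉₂ξ^j i<j (FinP.toℕ<n j) (mk≈₂ (code≡⇒2·≡ _ _ e))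
    residue-injective (Fin.suc Fin.zero) (Fin.suc Fin.zero) (s≤s ())
    residue-injective (Fin.suc (Fin.suc i)) (Fin.suc Fin.zero) (s≤s ())
    no-collision : (∃₂ λ i j → i Fin.< j × residue i ≡ residue j) → ⊥
    no-collision (i , j , i<j , e) = residue-injective i j i<j e

  -- The Teichmüller lift: τ c is the element of 𝒯 congruent to c.
  τ : R → R
  τ c = c ^R (2 ^ suc n)

  τ-resp-≈₂ : ∀ {x y} → x ≈₂ y → τ x ≡ τ y
  τ-resp-≈₂ x≈y = ≈₂⇒^2^[1+k]≡ x≈y n

  τ-ξ^i : ∀ i → τ (ξ ^R i) ≡ ξ ^R i
  τ-ξ^i i = begin
    (ξ ^R i) ^R (2 ^ suc n)        ≡⟨ cong ((ξ ^R i) ^R_) (sym 1+N≡2^m) ⟩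
    (ξ ^R i) ^R (suc N)            ≡⟨ sym (^R-* ξ (suc N) i) ⟩
    ξ ^R (i ℕ.+ N ℕ.* i)           ≡⟨ ^R-+ ξ i (N ℕ.* i) ⟩
    ξ ^R i * ξ ^R (N ℕ.* i)        ≡⟨ cong (λ e → ξ ^R i * ξ ^R e) (ℕP.*-comm N i) ⟩
    ξ ^R i * ξ ^R (i ℕ.* N)        ≡⟨ cong (ξ ^R i *_) (^R-* ξ i N) ⟩
    ξ ^R i * (ξ ^R N) ^R i         ≡⟨ cong (λ w → ξ ^R i * w ^R i) ξ^N≡1 ⟩
    ξ ^R i * 1R ^R i               ≡⟨ cong (ξ ^R i *_) (1^R i) ⟩
    ξ ^R i * 1R                    ≡⟨ *-identityʳ _ ⟩
    ξ ^R i                         ∎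
    where open ≡-Reasoning

  τ-0 : τ 0R ≡ 0R
  τ-0 = trans (cong (0R ^R_) (sym 1+N≡2^m)) (zeroˡ _)

  τ-fixes-T : ∀ {x} → InT x → τ x ≡ x
  τ-fixes-T (inj₁ refl)       = τ-0
  τ-fixes-T (inj₂ (i , refl)) = τ-ξ^i (toℕ i)

  τ-lift : ∀ c → InT (τ c) × τ c ≈₂ c
  τ-lift c with T-representative c
  ... | t , t∈T , c≈t = subst InT (sym τc≡t) t∈T , ≈₂-trans (≡⇒≈₂ τc≡t) (≈₂-sym c≈t)
    where
    τc≡t : τ c ≡ t
    τc≡t = trans (τ-resp-≈₂ c≈t) (τ-fixes-T t∈T)

  τ-InT : ∀ c → InT (τ c)
  τ-InT c = proj₁ (τ-lift c)

  τ≈₂ : ∀ c → τ c ≈₂ c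
  τ≈₂ c = proj₂ (τ-lift c)

  τ-≈₂-InT : ∀ {c y} → c ≈₂ y → InT y → τ c ≡ y
  τ-≈₂-InT c≈y y∈T = trans (τ-resp-≈₂ c≈y) (τ-fixes-T y∈T)

  InT-≈₂-injective : ∀ {x y} → InT x → InT y → x ≈₂ y → x ≡ y
  InT-≈₂-injective x∈T y∈T x≈y = trans (sym (τ-fixes-T x∈T)) (τ-≈₂-InT x≈y y∈T)

  InT-≢0⇒≉₂0 : ∀ {a} → InT a → a ≢ 0R → ¬ (a ≈₂ 0R)
  InT-≢0⇒≉₂0 a∈T a≢0 a≈0 = a≢0 (InT-≈₂-injective a∈T (inj₁ refl) a≈0)

  inverse₂ : ∀ {x} → ¬ (x ≈₂ 0R) → Σ R λ z → x * z ≈₂ 1R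
  inverse₂ {x} x≉0 with T-representative x
  ... | _ , inj₁ refl       , x≈0   = ⊥-elim (x≉0 x≈0)
  ... | _ , inj₂ (i , refl) , x≈ξ^i = ξ ^R (N ∸ toℕ i) , (begin
    x * ξ ^R (N ∸ toℕ i)              ≈⟨ *-resp-≈₂ x≈ξ^i (≈₂-refl {ξ ^R (N ∸ toℕ i)}) ⟩
    ξ ^R toℕ i * ξ ^R (N ∸ toℕ i)     ≡⟨ ξ^i*ξ^[N-i]≡1 (toℕ i) (ℕP.<⇒≤ (FinP.toℕ<n i)) ⟩
    1R                                ∎)
    where open ≈-Reasoning ≈₂-setoid

  *-cancelˡ-≈₂ : ∀ {a x y} → ¬ (a ≈₂ 0R) → a * x ≈₂ a * y → x ≈₂ y
  *-cancelˡ-≈₂ {a} {x} {y} a≉0 ax≈ay with inverse₂ a≉0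
  ... | z , az≈1 = begin
    x              ≡⟨ sym (*-identityˡ x) ⟩
    1R * x         ≈⟨ *-congʳ-≈₂ x (≈₂-sym az≈1) ⟩
    (a * z) * x    ≡⟨ solve 3 (λ A Z X → (A :* Z) :* X := Z :* (A :* X)) refl a z x ⟩
    z * (a * x)    ≈⟨ *-congˡ-≈₂ z ax≈ay ⟩
    z * (a * y)    ≡⟨ solve 3 (λ A Z Y → Z :* (A :* Y) := (A :* Z) :* Y) refl a z y ⟩
    (a * z) * y    ≈⟨ *-congʳ-≈₂ y az≈1 ⟩
    1R * y         ≡⟨ *-identityˡ y ⟩
    y              ∎
    where open ≈-Reasoning ≈₂-setoid

  +-cancelʳ-≈₂ : ∀ {x y} z → x + z ≈₂ y + z → x ≈₂ y
  +-cancelʳ-≈₂ {x} {y} z x+z≈y+z = begin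
    x              ≡⟨ solve 2 (λ X Z → X := (X :+ Z) :- Z) refl x z ⟩
    (x + z) - z    ≈⟨ +-congʳ-≈₂ (- z) x+z≈y+z ⟩
    (y + z) - z    ≡⟨ solve 2 (λ Y Z → (Y :+ Z) :- Z := Y) refl y z ⟩
    y              ∎
    where open ≈-Reasoning ≈₂-setoid

  *-≉₂0 : ∀ {x y} → ¬ (x ≈₂ 0R) → ¬ (y ≈₂ 0R) → ¬ (x * y ≈₂ 0R)
  *-≉₂0 {x} {y} x≉0 y≉0 xy≈0 = y≉0 (*-cancelˡ-≈₂ x≉0 (≈₂-trans xy≈0 (≡⇒≈₂ (sym (zeroʳ x)))))

  -≈₂0⇒≈₂ : ∀ {x y} → x - y ≈₂ 0R → x ≈₂ y
  -≈₂0⇒≈₂ {x} {y} x-y≈0 = +-cancelʳ-≈₂ (- y) (≈₂-trans x-y≈0 (≡⇒≈₂ (sym (-‿inverseʳ y))))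

  InT-≢⇒-≉₂0 : ∀ {x y} → InT x → InT y → x ≢ y → ¬ (x - y ≈₂ 0R)
  InT-≢⇒-≉₂0 x∈T y∈T x≢y x-y≈0 = x≢y (InT-≈₂-injective x∈T y∈T (-≈₂0⇒≈₂ x-y≈0))

  -- The affine group G

  affP-InT : ∀ p → Param p → ∀ x → InT x → InT (affP p x)
  affP-InT (a , b) _ x _ = τ-InT (a * x + b)

  affP-injective : ∀ p → Param p → ∀ x y → InT x → InT y → affP p x ≡ affP p y → x ≡ y
  affP-injective (a , b) (a∈T , _ , a≢0) x y x∈T y∈T gx≡gy =
    InT-≈₂-injective x∈T y∈T (*-cancelˡ-≈₂ (InT-≢0⇒≉₂0 a∈T a≢0) (+-cancelʳ-≈₂ b (begin
      a * x + b        ≈⟨ ≈₂-sym (τ≈₂ (a * x + b)) ⟩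
      τ (a * x + b)    ≡⟨ gx≡gy ⟩
      τ (a * y + b)    ≈⟨ τ≈₂ (a * y + b) ⟩
      a * y + b        ∎)))
    where open ≈-Reasoning ≈₂-setoid

  affP-surjective : ∀ p → Param p → ∀ y → InT y → ∃ λ x → InT x × affP p x ≡ y
  affP-surjective (a , b) (a∈T , _ , a≢0) y y∈T with inverse₂ (InT-≢0⇒≉₂0 a∈T a≢0)
  ... | z , az≈1 = x , τ-InT _ , τ-≈₂-InT ax+b≈y y∈T
    where
    x = τ (z * (y - b))
    ax+b≈y : a * x + b ≈₂ y
    ax+b≈y = begin
      a * x + b                ≈⟨ +-congʳ-≈₂ b (*-congˡ-≈₂ a (τ≈₂ _)) ⟩
      a * (z * (y - b)) + b    ≡⟨ solve 4 (λ A Z Y B → A :* (Z :* (Y :- B)) :+ B := (A :* Z) :* (Y :- B) :+ B) refl a z y b ⟩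
      (a * z) * (y - b) + b    ≈⟨ +-congʳ-≈₂ b (*-congʳ-≈₂ (y - b) az≈1) ⟩
      1R * (y - b) + b         ≡⟨ cong (_+ b) (*-identityˡ (y - b)) ⟩
      (y - b) + b              ≡⟨ solve 2 (λ Y B → (Y :- B) :+ B := Y) refl y b ⟩
      y                        ∎
      where open ≈-Reasoning ≈₂-setoid

  affP-∘ : ∀ p q → Param p → Param q → ∃ λ r → Param r × SameOnT (affP p ∘ affP q) (affP r)
  affP-∘ (a , b) (c , d) (a∈T , _ , a≢0) (c∈T , _ , c≢0) =
    (τ (a * c) , τ (a * d + b)) , (τ-InT _ , τ-InT _ , τ[ac]≢0) , λ x _ → τ-resp-≈₂ (composite x)
    where
    τ[ac]≢0 : τ (a * c) ≢ 0R
    τ[ac]≢0 τ[ac]≡0 = *-≉₂0 (InT-≢0⇒≉₂0 a∈T a≢0) (InT-≢0⇒≉₂0 c∈T c≢0)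
      (≈₂-trans (≈₂-sym (τ≈₂ (a * c))) (≡⇒≈₂ τ[ac]≡0))
    composite : ∀ x → a * τ (c * x + d) + b ≈₂ τ (a * c) * x + τ (a * d + b)
    composite x = begin
      a * τ (c * x + d) + b          ≈⟨ +-congʳ-≈₂ b (*-congˡ-≈₂ a (τ≈₂ _)) ⟩
      a * (c * x + d) + b            ≡⟨ solve 5 (λ A B C D X → A :* (C :* X :+ D) :+ B := (A :* C) :* X :+ (A :* D :+ B))
                                               refl a b c d x ⟩
      (a * c) * x + (a * d + b)      ≈⟨ +-resp-≈₂ (*-congʳ-≈₂ x (≈₂-sym (τ≈₂ _))) (≈₂-sym (τ≈₂ _)) ⟩
      τ (a * c) * x + τ (a * d + b)  ∎
      where open ≈-Reasoning ≈₂-setoid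

  affP-2-transitive : ∀ x y x′ y′ → InT x → InT y → InT x′ → InT y′ → x ≢ y → x′ ≢ y′
    → ∃ λ p → Param p × affP p x ≡ x′ × affP p y ≡ y′
  affP-2-transitive x y x′ y′ x∈T y∈T x′∈T y′∈T x≢y x′≢y′ = through (inverse₂ (InT-≢⇒-≉₂0 x∈T y∈T x≢y))
    where
    through : (Σ R λ z → (x - y) * z ≈₂ 1R) → ∃ λ p → Param p × affP p x ≡ x′ × affP p y ≡ y′
    through (z , [x-y]z≈1) = (a , b) , (τ-InT _ , τ-InT _ , a≢0)
                           , τ-≈₂-InT (proj₁ interpolation) x′∈T , τ-≈₂-InT (proj₂ interpolation) y′∈T
      where
      a = τ ((x′ - y′) * z)
      b = τ (x′ - a * x)
      interpolation : a * x + b ≈₂ x′ × a * y + b ≈₂ y′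
      interpolation = affine-interpolation [x-y]z≈1 (τ≈₂ ((x′ - y′) * z)) (τ≈₂ (x′ - a * x))
      a≢0 : a ≢ 0R
      a≢0 a≡0 = *-≉₂0 (InT-≢⇒-≉₂0 x′∈T y′∈T x′≢y′) (unit≉₂0 (≈₂-trans (≡⇒≈₂ (*R-comm z (x - y))) [x-y]z≈1))
        (≈₂-trans (≈₂-sym (τ≈₂ _)) (≡⇒≈₂ a≡0))

  aff-0 : ∀ a b → InT b → aff a b 0R ≡ b
  aff-0 a b b∈T = τ-≈₂-InT (≡⇒≈₂ (trans (cong (_+ b) (zeroʳ a)) (+-identityˡ b))) b∈T

  aff-injective : ∀ {a b a′ b′} → Param (a , b) → Param (a′ , b′) → SameOnT (aff a b) (aff a′ b′) → a ≡ a′ × b ≡ b′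
  aff-injective {a} {b} {a′} {b′} (a∈T , b∈T , a≢0) (a′∈T , b′∈T , _) same = a≡a′ , b≡b′
    where
    open ≈-Reasoning ≈₂-setoid
    b≡b′ : b ≡ b′
    b≡b′ = trans (sym (aff-0 a b b∈T)) (trans (same 0R (inj₁ refl)) (aff-0 a′ b′ b′∈T))
    a≡a′ : a ≡ a′
    a≡a′ = InT-≈₂-injective a∈T a′∈T (*-cancelˡ-≈₂ (InT-≢0⇒≉₂0 a∈T a≢0) (+-cancelʳ-≈₂ b (begin
      a * a + b      ≈⟨ ≈₂-sym (τ≈₂ _) ⟩
      aff a b a      ≡⟨ same a a∈T ⟩
      aff a′ b′ a    ≈⟨ τ≈₂ _ ⟩
      a′ * a + b′    ≡⟨ cong₂ _+_ (*R-comm a′ a) (sym b≡b′) ⟩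
      a * a′ + b     ∎)))

  ξ^-injective : ∀ (i j : Fin N) → ξ ^R toℕ i ≡ ξ ^R toℕ j → i ≡ j
  ξ^-injective i j ξ^i≡ξ^j with ℕP.<-cmp (toℕ i) (toℕ j)
  ... | tri< i<j _ _ = ⊥-elim (ξ^i≉₂ξ^j i<j (FinP.toℕ<n j) (≡⇒≈₂ ξ^i≡ξ^j))
  ... | tri≈ _ i≡j _ = FinP.toℕ-injective i≡j
  ... | tri> _ _ j<i = ⊥-elim (ξ^i≉₂ξ^j j<i (FinP.toℕ<n i) (≡⇒≈₂ (sym ξ^i≡ξ^j)))

  T-elem : Fin (suc N) → R
  T-elem Fin.zero    = 0R
  T-elem (Fin.suc i) = ξ ^R toℕ i

  T-elem-InT : ∀ i → InT (T-elem i)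
  T-elem-InT Fin.zero    = inj₁ refl
  T-elem-InT (Fin.suc i) = inj₂ (i , refl)

  T-elem-injective : ∀ i j → T-elem i ≡ T-elem j → i ≡ j
  T-elem-injective Fin.zero    Fin.zero    _ = refl
  T-elem-injective Fin.zero    (Fin.suc j) e = ⊥-elim (ξ^k≉₂0 (toℕ j) (≡⇒≈₂ (sym e)))
  T-elem-injective (Fin.suc i) Fin.zero    e = ⊥-elim (ξ^k≉₂0 (toℕ i) (≡⇒≈₂ e))
  T-elem-injective (Fin.suc i) (Fin.suc j) e = cong Fin.suc (ξ^-injective i j e)

  T-elem-surjective : ∀ {b} → InT b → Σ (Fin (suc N)) λ i → T-elem i ≡ b
  T-elem-surjective (inj₁ refl)       = Fin.zero , refl
  T-elem-surjective (inj₂ (i , refl)) = Fin.suc i , refl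

  G-row : Fin (2 ^ suc n ℕ.* N) → Fin (suc N)
  G-row k = Fin.cast (sym 1+N≡2^m) (proj₁ (Fin.remQuot {2 ^ suc n} N k))

  G-col : Fin (2 ^ suc n ℕ.* N) → Fin N
  G-col k = proj₂ (Fin.remQuot {2 ^ suc n} N k)

  G-enum : Fin (2 ^ suc n ℕ.* N) → R × R
  G-enum k = ξ ^R toℕ (G-col k) , T-elem (G-row k)

  G-enum-Param : ∀ k → Param (G-enum k)
  G-enum-Param k = inj₂ (G-col k , refl) , T-elem-InT (G-row k) , λ a≡0 → ξ^k≉₂0 (toℕ (G-col k)) (≡⇒≈₂ a≡0)

  G-enum-injective : ∀ k k′ → SameOnT (affP (G-enum k)) (affP (G-enum k′)) → k ≡ k′
  G-enum-injective k k′ same = begin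
    k                                                      ≡⟨ sym (FinP.combine-remQuot {2 ^ suc n} N k) ⟩
    uncurry (Fin.combine {2 ^ suc n}) (Fin.remQuot N k)    ≡⟨ cong (uncurry Fin.combine) (cong₂ _,_ rows≡ cols≡) ⟩
    uncurry (Fin.combine {2 ^ suc n}) (Fin.remQuot N k′)   ≡⟨ FinP.combine-remQuot {2 ^ suc n} N k′ ⟩
    k′                                                     ∎
    where
    open ≡-Reasoning
    params≡ = aff-injective (G-enum-Param k) (G-enum-Param k′) same
    cols≡ : G-col k ≡ G-col k′
    cols≡ = ξ^-injective (G-col k) (G-col k′) (proj₁ params≡)
    rows≡ : proj₁ (Fin.remQuot {2 ^ suc n} N k) ≡ proj₁ (Fin.remQuot {2 ^ suc n} N k′)
    rows≡ = begin
      proj₁ (Fin.remQuot N k)          ≡⟨ sym (FinP.cast-involutive 1+N≡2^m (sym 1+N≡2^m) _) ⟩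
      Fin.cast 1+N≡2^m (G-row k)       ≡⟨ cong (Fin.cast 1+N≡2^m) (T-elem-injective (G-row k) (G-row k′) (proj₂ params≡)) ⟩
      Fin.cast 1+N≡2^m (G-row k′)      ≡⟨ FinP.cast-involutive 1+N≡2^m (sym 1+N≡2^m) _ ⟩
      proj₁ (Fin.remQuot N k′)         ∎

  G-enum-surjective : ∀ p → Param p → ∃ λ k → SameOnT (affP p) (affP (G-enum k))
  G-enum-surjective (a , b) (inj₁ a≡0 , _ , a≢0) = ⊥-elim (a≢0 a≡0)
  G-enum-surjective (a , b) (inj₂ (j , a≡ξ^j) , b∈T , _) = k , λ x _ → cong (λ p → affP p x) (sym G-enum-k≡[a,b])
    where
    open ≡-Reasoning
    i = proj₁ (T-elem-surjective b∈T)
    k = Fin.combine {2 ^ suc n} {N} (Fin.cast 1+N≡2^m i) j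
    indices : Fin.remQuot {2 ^ suc n} N k ≡ (Fin.cast 1+N≡2^m i , j)
    indices = FinP.remQuot-combine (Fin.cast 1+N≡2^m i) j
    G-enum-k≡[a,b] : G-enum k ≡ (a , b)
    G-enum-k≡[a,b] = begin
      G-enum k
        ≡⟨ cong (λ q → ξ ^R toℕ (proj₂ q) , T-elem (Fin.cast (sym 1+N≡2^m) (proj₁ q))) indices ⟩
      ξ ^R toℕ j , T-elem (Fin.cast (sym 1+N≡2^m) (Fin.cast 1+N≡2^m i))
        ≡⟨ cong₂ _,_ (sym a≡ξ^j) (trans (cong T-elem (FinP.cast-involutive (sym 1+N≡2^m) 1+N≡2^m i)) (proj₂ (T-elem-surjective b∈T))) ⟩
      a , b ∎

  -- Invariance of Ω

  -- The sums sumT₄ and sumTR of Defs run over T-list.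
  T-list : List R
  T-list = List.filter InT? (allVec (suc n))

  ∈-T-list : ∀ {x} → InT x → x ∈ T-list
  ∈-T-list {x} x∈T = ∈-filter⁺ InT? (allVec-complete (suc n) x) x∈T

  T-list-InT : ∀ {x} → x ∈ T-list → InT x
  T-list-InT x∈ = proj₂ (∈-filter⁻ InT? {xs = allVec (suc n)} x∈)

  T-list-unique : Unique T-list
  T-list-unique = filter⁺ InT? (allVec-unique (suc n))

  affP-↭ : ∀ p → Param p → List.map (affP p) T-list ↭ T-list
  affP-↭ p prm = map-↭ T-list-unique
    (λ x∈ y∈ → affP-injective p prm _ _ (T-list-InT x∈) (T-list-InT y∈))
    (λ x∈ → ∈-T-list (affP-InT p prm _ (T-list-InT x∈)))
    (λ y∈ → let x , x∈T , gx≡y = affP-surjective p prm _ (T-list-InT y∈) in x , ∈-T-list x∈T , gx≡y)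

  sumT₄-reindex : ∀ p → Param p → ∀ {c c′ : R → Z4} → (∀ x → InT x → c′ (affP p x) ≡ c x) → sumT₄ c′ ≡ sumT₄ c
  sumT₄-reindex p prm {c} {c′} c′∘g≡c =
    trans (Sum₄.sumOver-reindex c′ (affP-↭ p prm)) (Sum₄.sumOver-cong {xs = T-list} λ x∈ → c′∘g≡c _ (T-list-InT x∈))

  sumTR-reindex : ∀ p → Param p → ∀ {c c′ : R → Z4} → (∀ x → InT x → c′ (affP p x) ≡ c x)
    → ∀ (F : R → R) → sumTR (λ y → c′ y ·ᵥ F y) ≡ sumTR (λ x → c x ·ᵥ F (affP p x))
  sumTR-reindex p prm {c} {c′} c′∘g≡c F = trans (Sumᴿ.sumOver-reindex (λ y → c′ y ·ᵥ F y) (affP-↭ p prm))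
    (Sumᴿ.sumOver-cong {xs = T-list} λ {x} x∈ → cong (_·ᵥ F (affP p x)) (c′∘g≡c x (T-list-InT x∈)))

  aff-expansion : ∀ {a b x} → InT a → InT b → InT x
    → aff a b x ≡ a * x + (⟦ 2₄ ⟧ * (a * b) ^R (2 ^ n) * x ^R (2 ^ n) + b)
  aff-expansion {a} {b} {x} a∈T b∈T x∈T = begin
    (a * x + b) ^R (2 ^ suc n)
      ≡⟨ binomial-2^[1+k] (a * x) b n ⟩
    (a * x) ^R (2 ^ suc n) + τ b + ⟦ 2₄ ⟧ * (a * x * b) ^R (2 ^ n)
      ≡⟨ cong₂ (λ p q → p + q + ⟦ 2₄ ⟧ * (a * x * b) ^R (2 ^ n))
               (trans (*-^R a x (2 ^ suc n)) (cong₂ _*_ (τ-fixes-T a∈T) (τ-fixes-T x∈T))) (τ-fixes-T b∈T) ⟩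
    a * x + b + ⟦ 2₄ ⟧ * (a * x * b) ^R (2 ^ n)
      ≡⟨ cong (λ w → a * x + b + ⟦ 2₄ ⟧ * w ^R (2 ^ n)) (solve 3 (λ A X B → A :* X :* B := (A :* B) :* X) refl a x b) ⟩
    a * x + b + ⟦ 2₄ ⟧ * ((a * b) * x) ^R (2 ^ n)
      ≡⟨ cong (λ w → a * x + b + ⟦ 2₄ ⟧ * w) (*-^R (a * b) x (2 ^ n)) ⟩
    a * x + b + ⟦ 2₄ ⟧ * ((a * b) ^R (2 ^ n) * x ^R (2 ^ n))
      ≡⟨ solve 5 (λ A X B K Y → A :* X :+ B :+ con 2₄ :* (K :* Y) := A :* X :+ (con 2₄ :* K :* Y :+ B))
               refl a x b ((a * b) ^R (2 ^ n)) (x ^R (2 ^ n)) ⟩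
    a * x + (⟦ 2₄ ⟧ * (a * b) ^R (2 ^ n) * x ^R (2 ^ n) + b) ∎
    where open ≡-Reasoning

  aff^[2^j+1]≈₂ : ∀ a b x j → let e = 2 ^ j; A = a ^R e; B = b ^R e in
    aff a b x ^R (e ℕ.+ 1) ≈₂ (A * a) * x ^R (e ℕ.+ 1) + ((A * b) * x ^R e + ((a * B) * x + B * b))
  aff^[2^j+1]≈₂ a b x j = begin
    aff a b x ^R (e ℕ.+ 1)                    ≈⟨ ^R-resp-≈₂ (τ≈₂ (a * x + b)) (e ℕ.+ 1) ⟩
    (a * x + b) ^R (e ℕ.+ 1)                  ≡⟨ trans (^R-+ (a * x + b) e 1) (cong ((a * x + b) ^R e *_) (^R-1 (a * x + b))) ⟩
    (a * x + b) ^R e * (a * x + b)            ≈⟨ *-congʳ-≈₂ (a * x + b) (binomial-≈₂ (a * x) b j) ⟩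
    ((a * x) ^R e + B) * (a * x + b)          ≡⟨ cong (λ w → (w + B) * (a * x + b)) (*-^R a x e) ⟩
    (A * X + B) * (a * x + b)                 ≡⟨ solve 6 (λ A′ a′ X′ x′ B′ b′ → (A′ :* X′ :+ B′) :* (a′ :* x′ :+ b′)
                                                       := (A′ :* a′) :* (X′ :* x′) :+ ((A′ :* b′) :* X′ :+ ((a′ :* B′) :* x′ :+ B′ :* b′)))
                                                       refl A a X x B b ⟩
    (A * a) * (X * x) + ((A * b) * X + ((a * B) * x + B * b))
                                              ≡⟨ cong (λ w → (A * a) * w + ((A * b) * X + ((a * B) * x + B * b)))
                                                      (sym (trans (^R-+ x e 1) (cong (X *_) (^R-1 x)))) ⟩
    (A * a) * x ^R (e ℕ.+ 1) + ((A * b) * X + ((a * B) * x + B * b)) ∎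
    where
    open ≈-Reasoning ≈₂-setoid
    e = 2 ^ j
    A = a ^R e
    B = b ^R e
    X = x ^R e

  sum-c·aff≡0 : ∀ {a b} → InT a → InT b → ∀ (c : R → Z4) → sumT₄ c ≡ 0₄ → sumTR (λ x → c x ·ᵥ x) ≡ 0R
    → sumTR (λ x → c x ·ᵥ aff a b x) ≡ 0R
  sum-c·aff≡0 {a} {b} a∈T b∈T c Σc≡0 Σcx≡0 = trans
    (Sumᴿ.sumOver-cong {xs = T-list} (λ {x} x∈ → cong (c x ·ᵥ_) (aff-expansion a∈T b∈T (T-list-InT x∈))))
    (sumᴿ-affine-≡0 T-list c a (λ x → x) _ (trans (cong (a *_) Σcx≡0) (zeroʳ a))
      (sumᴿ-affine-≡0 T-list c (⟦ 2₄ ⟧ * K) (λ x → x ^R (2 ^ n)) (λ _ → b) 2KSₑ≡0 Σcb≡0))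
    where
    open ≡-Reasoning
    K  = (a * b) ^R (2 ^ n)
    Sₑ = sumTR (λ x → c x ·ᵥ x ^R (2 ^ n))
    Sₑ≈0 : Sₑ ≈₂ 0R
    Sₑ≈0 = ≈₂-trans (sumᴿ-frobenius T-list c n) (≡⇒≈₂ (trans (cong (_^R (2 ^ n)) Σcx≡0) (0^R-2^k n)))
    2KSₑ≡0 : (⟦ 2₄ ⟧ * K) * Sₑ ≡ 0R
    2KSₑ≡0 = begin
      (⟦ 2₄ ⟧ * K) * Sₑ   ≡⟨ solve 2 (λ K′ S → (con 2₄ :* K′) :* S := K′ :* (con 2₄ :* S)) refl K Sₑ ⟩
      K * (⟦ 2₄ ⟧ * Sₑ)   ≡⟨ cong (K *_) (≈₂0⇒2*≡0 Sₑ≈0) ⟩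
      K * 0R              ≡⟨ zeroʳ K ⟩
      0R                  ∎
    Σcb≡0 : sumTR (λ x → c x ·ᵥ b) ≡ 0R
    Σcb≡0 = trans (sumᴿ-const T-list c b) (trans (cong (_·ᵥ b) Σc≡0) (·ᵥ-zeroˡ b))

  sum-c·aff^[2^j+1]≈₂0 : ∀ a b (c : R → Z4) j → sumT₄ c ≡ 0₄ → sumTR (λ x → c x ·ᵥ x) ≡ 0R
    → sumTR (λ x → c x ·ᵥ x ^R (2 ^ j ℕ.+ 1)) ≈₂ 0R
    → sumTR (λ x → c x ·ᵥ aff a b x ^R (2 ^ j ℕ.+ 1)) ≈₂ 0R
  sum-c·aff^[2^j+1]≈₂0 a b c j Σc≡0 Σcx≡0 Σcx^[e+1]≈0 = ≈₂-trans
    (sumᴿ-resp-≈₂ {T-list} (λ {x} _ → ·-resp-≈₂ (c x) (aff^[2^j+1]≈₂ a b x j)))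
    (sumᴿ-affine-≈₂0 T-list c (A * a) _ _ Σcx^[e+1]≈0
      (sumᴿ-affine-≈₂0 T-list c (A * b) (λ x → x ^R e) _ Σcx^e≈0
        (sumᴿ-affine-≈₂0 T-list c (a * B) (λ x → x) (λ _ → B * b) (≡⇒≈₂ Σcx≡0) Σc·Bb≈0)))
    where
    e = 2 ^ j
    A = a ^R e
    B = b ^R e
    Σcx^e≈0 : sumTR (λ x → c x ·ᵥ x ^R e) ≈₂ 0R
    Σcx^e≈0 = ≈₂-trans (sumᴿ-frobenius T-list c j) (≡⇒≈₂ (trans (cong (_^R e) Σcx≡0) (0^R-2^k j)))
    Σc·Bb≈0 : sumTR (λ x → c x ·ᵥ (B * b)) ≈₂ 0R
    Σc·Bb≈0 = ≡⇒≈₂ (trans (sumᴿ-const T-list c (B * b)) (trans (cong (_·ᵥ (B * b)) Σc≡0) (·ᵥ-zeroˡ (B * b))))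

  Ω-invariant : ∀ (J : ℕ → Set) p → Param p → ∀ (c c′ : R → Z4)
    → (∀ x → InT x → c′ (affP p x) ≡ c x) → Solves J c → Solves J c′
  Ω-invariant J (a , b) prm@(a∈T , b∈T , _) c c′ c′∘g≡c (Σc≡0 , Σcx≡0 , Σcx^[e+1]) =
      trans (sumT₄-reindex (a , b) prm {c} {c′} c′∘g≡c) Σc≡0
    , trans (sumTR-reindex (a , b) prm {c} {c′} c′∘g≡c (λ y → y)) (sum-c·aff≡0 a∈T b∈T c Σc≡0 Σcx≡0)
    , λ j j∈J → trans (cong (2₄ ·ᵥ_) (sumTR-reindex (a , b) prm {c} {c′} c′∘g≡c (λ y → y ^R (2 ^ j ℕ.+ 1))))
                  (≈₂0⇒2·≡0 (sum-c·aff^[2^j+1]≈₂0 a b c j Σc≡0 Σcx≡0 (2·≡0⇒≈₂0 (Σcx^[e+1] j j∈J))))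

-- ℕ multiplication, as in the statement; the modules above use the ring multiplication _*_.

open import Data.Nat using (_*_)

theorem20 : (m : ℕ) → 1 ≤ m → (hc : Vec Z4 m)
  → PrimitiveZ2 m (h2Poly hc)
  → (hPoly hc P4.∣ P4.Xpow-1 (2 ^ m ∸ 1))
  → let open GR m hc in
    -- each g ∈ G maps 𝒯 into 𝒯
    (∀ p → Param p → ∀ x → InT x → InT (affP p x))
    -- each g ∈ G is injective on 𝒯
  × (∀ p → Param p → ∀ x y → InT x → InT y → affP p x ≡ affP p y → x ≡ y)
    -- each g ∈ G is surjective onto 𝒯
  × (∀ p → Param p → ∀ y → InT y → ∃ λ x → InT x × affP p x ≡ y)
    -- G is closed under composition (as permutations of 𝒯)
  × (∀ p q → Param p → Param q
       → ∃ λ r → Param r × SameOnT (affP p ∘ affP q) (affP r))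
    -- G is doubly transitive on 𝒯
  × (∀ x y x′ y′ → InT x → InT y → InT x′ → InT y′ → x ≢ y → x′ ≢ y′
       → ∃ λ p → Param p × affP p x ≡ x′ × affP p y ≡ y′)
    -- invariance of Ω under G
  × (∀ (J : ℕ → Set) p → Param p → ∀ (c c′ : R → Z4)
       → (∀ x → InT x → c′ (affP p x) ≡ c x)
       → Solves J c → Solves J c′)
    -- |G| = 2^m (2^m - 1)
  × (∃ λ (e : Fin (2 ^ m * (2 ^ m ∸ 1)) → R × R)
       → (∀ k → Param (e k))
       × (∀ k k′ → SameOnT (affP (e k)) (affP (e k′)) → k ≡ k′)
       × (∀ p → Param p → ∃ λ k → SameOnT (affP p) (affP (e k))))
theorem20 zero    ()  hc h₂-primitive h∣X^N-1
theorem20 (suc n) _   hc h₂-primitive h∣X^N-1 =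
    affP-InT , affP-injective , affP-surjective , affP-∘ , affP-2-transitive , Ω-invariant
  , G-enum , G-enum-Param , G-enum-injective , G-enum-surjective
  where open PrimitiveGaloisRing n hc h₂-primitive h∣X^N-1
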